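{- (1) If $M:\langle\Gamma\vdash U\rangle$ is derivable and $M\rhd^*_\beta N$, then $N:\langle\Gamma\restriction_N\vdash U\rangle$ is derivable. (2) If $M:\langle\Gamma\vdash U\rangle$ is derivable and $M\rhd^*_h N$, then $N:\langle\Gamma\restriction_N\vdash U\rangle$ is derivable.
   Context: Indexes: finite sequences of natural numbers ($\mathcal L_{\mathbb N}$), $\oslash$ empty, $i::L$ prepending $i$, $L_1\preceq L_2$ (also $L_2\succeq L_1$) iff $L_2=L_1::L_3$ for some $L_3$ (concatenation). Terms: over a countably infinite set $\mathcal V$, terms $\mathcal M$, free indexed variables $\mathrm{fv}$, degree $d$, joinability $\diamond$ defined simultaneously: $x^L\in\mathcal M$ ($\mathrm{fv}=\{x^L\}$, $d=L$); $MN\in\mathcal M$ when $d(M)\preceq d(N)$, $M\diamond N$ ($\mathrm{fv}$ union, $d(MN)=d(M)$); $\lambda x^L.M\in\mathcal M$ when $L\succeq d(M)$ ($\mathrm{fv}(M)\setminus\{x^L\}$, $d=d(M)$). $M\diamond N$ iff $x^L\in\mathrm{fv}(M)$, $x^K\in\mathrm{fv}(N)$ imply $L=K$. Terms modulo $\alpha$; $M[x^L:=N]$ defined only if $M\diamond N$, $d(N)=L$. $\rhd_\beta$: least relation compatible with abstraction and application containing $(\lambda x^L.M)N\rhd_\beta M[x^L:=N]$ ($d(N)=L$); weak head reduction $(\lambda x^L.M)NN_1\dots N_n\rhd_h M[x^L:=N]N_1\dots N_n$ ($n\ge0$); $\rhd^*$ reflexive–transitive closure. Lifting $(x^L)^{+i}=x^{i::L}$,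 $(M_1M_2)^{+i}=M_1^{+i}M_2^{+i}$, $(\lambda x^L.M)^{+i}=\lambda x^{i::L}.M^{+i}$. Types: atomic types $\mathcal A$, expansion variables $\overline e_0,\overline e_1,\dots$; $\mathbb T\subseteq\mathbb U$ with degree: $a\in\mathbb T$ ($d=\oslash$); $U\to T\in\mathbb T$ for $U\in\mathbb U,T\in\mathbb T$ ($d=\oslash$); $\omega^L\in\mathbb U$ ($d=L$); $U_1\sqcap U_2$ if $d(U_1)=d(U_2)$ (same degree); $\overline e_iU$ ($d=i::d(U)$); modulo $\sqcap$ commutative, associative, idempotent, $\overline e_i(U_1\sqcap U_2)=\overline e_iU_1\sqcap\overline e_iU_2$, $\omega^L\sqcap U=U$ ($d(U)=L$), $\overline e_i\omega^K=\omega^{i::K}$. Environments: finite sets of declarations $x^L:U$ (at most one per $x^L$); $\Gamma,\Delta$ disjoint union; $env^\omega_M$ assigns $\omega^L$ to each $x^L\in\mathrm{fv}(M)$; $\Gamma_1\sqcap\Gamma_2$ intersects types of common variables, keeps others; $\overline e_j\Gamma$ replaces $x^L:U$ by $x^{j::L}:\overline e_jU$; $\Gamma_1\diamond\Gamma_2$ iff $x^L\in\mathrm{dom}\,\Gamma_1$, $x^K\in\mathrm{dom}\,\Gamma_2$ imply $L=K$; $\Gamma\restriction_N$ restriction of $\Gamma$ to $\mathrm{fv}(N)$. Subtyping $\sqsubseteq$: least relation on types, environments and typings closed under reflexivity, transitivity, $U_1\sqcap U_2\sqsubseteq U_1$ ($d(U_1)=d(U_2)$), $U_1\sqcap U_2\sqsubseteq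 V_1\sqcap V_2$ if $U_i\sqsubseteq V_i$, $U_1\to T_1\sqsubseteq U_2\to T_2$ if $U_2\sqsubseteq U_1$, $T_1\sqsubseteq T_2$, $\overline e_iU_1\sqsubseteq\overline e_iU_2$ if $U_1\sqsubseteq U_2$, $\Gamma,y^L:U_1\sqsubseteq\Gamma,y^L:U_2$ if $U_1\sqsubseteq U_2$, $\langle\Gamma_1\vdash U_1\rangle\sqsubseteq\langle\Gamma_2\vdash U_2\rangle$ if $U_1\sqsubseteq U_2$, $\Gamma_2\sqsubseteq\Gamma_1$. Typing rules ($T\in\mathbb T$): (ax) $x^\oslash:\langle(x^\oslash:T)\vdash T\rangle$; ($\omega$) $M:\langle env^\omega_M\vdash\omega^{d(M)}\rangle$; ($\to_I$) $M:\langle\Gamma,(x^L:U)\vdash T\rangle\Rightarrow\lambda x^L.M:\langle\Gamma\vdash U\to T\rangle$; ($\to'_I$) $M:\langle\Gamma\vdash T\rangle$, $x^L\notin\mathrm{dom}\,\Gamma\Rightarrow\lambda x^L.M:\langle\Gamma\vdash\omega^L\to T\rangle$; ($\to_E$) $M_1:\langle\Gamma_1\vdash U\to T\rangle$, $M_2:\langle\Gamma_2\vdash U\rangle$, $\Gamma_1\diamond\Gamma_2\Rightarrow M_1M_2:\langle\Gamma_1\sqcap\Gamma_2\vdash T\rangle$; ($\sqcap_I$) $M:\langle\Gamma\vdash U_1\rangle$, $M:\langle\Gamma\vdash U_2\rangle\Rightarrow M:\langle\Gamma\vdash U_1\sqcap U_2\rangle$; ($e$) $M:\langle\Gamma\vdash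 U\rangle\Rightarrow M^{+j}:\langle\overline e_j\Gamma\vdash\overline e_jU\rangle$; ($\sqsubseteq$) $M:\langle\Gamma\vdash U\rangle$, $\langle\Gamma\vdash U\rangle\sqsubseteq\langle\Gamma'\vdash U'\rangle\Rightarrow M:\langle\Gamma'\vdash U'\rangle$. -}

module Defs where

-- Terms are represented in the locally nameless style: free (indexed)
-- variables are named  fv x L  (the paper's x^L, with x ∈ ℕ as the countable
-- variable set), bound variables are de Bruijn indices  bv n.  This gives
-- canonical representatives of terms modulo α.  Abstraction bodies are
-- handled by opening with a fresh name, quantified cofinitely.

open import Data.Nat using (ℕ; zero; suc; _≟_)
open import Data.Bool using (Bool; true; false; _∧_; _∨_; if_then_else_)
open import Data.List using (List; []; _∷_; _++_)
open import Data.List.Properties using (≡-dec)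
open import Data.List.Membership.Propositional using (_∉_)
open import Data.Maybe using (Maybe; just; nothing; Is-just)
open import Data.Maybe.Relation.Binary.Pointwise using (Pointwise)
open import Data.Product using (Σ; ∃; _×_; _,_)
open import Relation.Binary.PropositionalEquality using (_≡_)
open import Relation.Binary.Construct.Closure.ReflexiveTransitive using (Star)
open import Relation.Nullary.Decidable using (⌊_⌋)

Idx : Set
Idx = List ℕ

_⪯_ : Idx → Idx → Set
L₁ ⪯ L₂ = ∃ λ L₃ → L₂ ≡ L₁ ++ L₃

_=ℕ_ : ℕ → ℕ → Bool
m =ℕ n = ⌊ m ≟ n ⌋

_=ᴵ_ : Idx → Idx → Bool
L =ᴵ K = ⌊ ≡-dec _≟_ L K ⌋

data Tm : Set where
  fv  : ℕ → Idx → Tm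
  bv  : ℕ → Tm
  app : Tm → Tm → Tm
  lam : Idx → Tm → Tm     -- λ x^L . M  (binder index L, name irrelevant)

openAt : ℕ → Tm → Tm → Tm
openAt k u (fv x L)  = fv x L
openAt k u (bv n)    = if n =ℕ k then u else bv n
openAt k u (app M N) = app (openAt k u M) (openAt k u N)
openAt k u (lam L M) = lam L (openAt (suc k) u M)

_^_ : Tm → Tm → Tm
M ^ u = openAt 0 u M

isFree : ℕ → Idx → Tm → Bool
isFree x L (fv y K)  = (x =ℕ y) ∧ (L =ᴵ K)
isFree x L (bv n)    = false
isFree x L (app M N) = isFree x L M ∨ isFree x L N
isFree x L (lam K M) = isFree x L M

-- degree, computed with the indexes of enclosing binders
nthIdx : List Idx → ℕ → Idx
nthIdx []       n       = []
nthIdx (L ∷ Δ)  zero    = L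
nthIdx (L ∷ Δ)  (suc n) = nthIdx Δ n

degAt : List Idx → Tm → Idx
degAt Δ (fv x L)  = L
degAt Δ (bv n)    = nthIdx Δ n
degAt Δ (app M N) = degAt Δ M
degAt Δ (lam L M) = degAt (L ∷ Δ) M

d : Tm → Idx
d = degAt []

_◇_ : Tm → Tm → Set
M ◇ N = ∀ x L K → isFree x L M ≡ true → isFree x K N ≡ true → L ≡ K

data 𝓜 : Tm → Set where
  var : ∀ x L → 𝓜 (fv x L)
  app : ∀ {M N} → 𝓜 M → 𝓜 N → d M ⪯ d N → M ◇ N → 𝓜 (app M N)
  lam : ∀ {L M} (S : List ℕ) →
        (∀ x → x ∉ S → 𝓜 (M ^ fv x L) × d (M ^ fv x L) ⪯ L) →
        𝓜 (lam L M)

lift : ℕ → Tm → Tm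
lift i (fv x L)  = fv x (i ∷ L)
lift i (bv n)    = bv n
lift i (app M N) = app (lift i M) (lift i N)
lift i (lam L M) = lam (i ∷ L) (lift i M)

data _▷β_ : Tm → Tm → Set where
  beta : ∀ {L M N} → d N ≡ L → app (lam L M) N ▷β (M ^ N)
  appˡ : ∀ {M M′ N} → M ▷β M′ → app M N ▷β app M′ N
  appʳ : ∀ {M N N′} → N ▷β N′ → app M N ▷β app M N′
  lam  : ∀ {L M M′} (S : List ℕ) →
         (∀ x → x ∉ S → (M ^ fv x L) ▷β (M′ ^ fv x L)) →
         lam L M ▷β lam L M′

data _▷h_ : Tm → Tm → Set where
  beta : ∀ {L M N} → d N ≡ L → app (lam L M) N ▷h (M ^ N)
  appˡ : ∀ {M M′ N} → M ▷h M′ → app M N ▷h app M′ N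

_⟶β_ : Tm → Tm → Set
M ⟶β N = 𝓜 M × 𝓜 N × M ▷β N

_⟶h_ : Tm → Tm → Set
M ⟶h N = 𝓜 M × 𝓜 N × M ▷h N

_▷β*_ : Tm → Tm → Set
_▷β*_ = Star _⟶β_

_▷h*_ : Tm → Tm → Set
_▷h*_ = Star _⟶h_

-- Types (raw syntax; the paper's types are classes modulo _≈_ below)

data Ty : Set where
  atom : ℕ → Ty
  _⇒_  : Ty → Ty → Ty
  ω    : Idx → Ty
  _⊓_  : Ty → Ty → Ty
  e    : ℕ → Ty → Ty

infixr 6 _⇒_
infixl 7 _⊓_

deg : Ty → Idx
deg (atom a)  = []
deg (U ⇒ T)   = []
deg (ω L)     = L
deg (U ⊓ V)   = deg U
deg (e i U)   = i ∷ deg U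

mutual
  data 𝕋 : Ty → Set where
    atom : ∀ a → 𝕋 (atom a)
    arr  : ∀ {U T} → 𝕌 U → 𝕋 T → 𝕋 (U ⇒ T)

  data 𝕌 : Ty → Set where
    ty    : ∀ {T} → 𝕋 T → 𝕌 T
    omega : ∀ L → 𝕌 (ω L)
    inter : ∀ {U V} → 𝕌 U → 𝕌 V → deg U ≡ deg V → 𝕌 (U ⊓ V)
    expn  : ∀ {U} i → 𝕌 U → 𝕌 (e i U)

data _≈_ : Ty → Ty → Set where
  ≈-refl  : ∀ {U} → U ≈ U
  ≈-sym   : ∀ {U V} → U ≈ V → V ≈ U
  ≈-trans : ∀ {U V W} → U ≈ V → V ≈ W → U ≈ W
  ⇒-cong  : ∀ {U U′ T T′} → U ≈ U′ → T ≈ T′ → (U ⇒ T) ≈ (U′ ⇒ T′)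
  ⊓-cong  : ∀ {U U′ V V′} → U ≈ U′ → V ≈ V′ → (U ⊓ V) ≈ (U′ ⊓ V′)
  e-cong  : ∀ {U U′} i → U ≈ U′ → e i U ≈ e i U′
  ⊓-comm  : ∀ {U V} → deg U ≡ deg V → (U ⊓ V) ≈ (V ⊓ U)
  ⊓-assoc : ∀ {U V W} → deg U ≡ deg V → deg V ≡ deg W →
            ((U ⊓ V) ⊓ W) ≈ (U ⊓ (V ⊓ W))
  ⊓-idem  : ∀ {U} → (U ⊓ U) ≈ U
  e-⊓     : ∀ {U V} i → deg U ≡ deg V → e i (U ⊓ V) ≈ (e i U ⊓ e i V)
  ω-unit  : ∀ {L U} → deg U ≡ L → (ω L ⊓ U) ≈ U
  e-ω     : ∀ i K → e i (ω K) ≈ ω (i ∷ K)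

data _⊑_ : Ty → Ty → Set where
  ⊑-refl  : ∀ {U V} → U ≈ V → U ⊑ V           -- reflexivity (on classes)
  ⊑-trans : ∀ {U V W} → U ⊑ V → V ⊑ W → U ⊑ W
  ⊓-elim  : ∀ {U₁ U₂} → 𝕌 (U₁ ⊓ U₂) → (U₁ ⊓ U₂) ⊑ U₁
  ⊓-mono  : ∀ {U₁ U₂ V₁ V₂} → 𝕌 (U₁ ⊓ U₂) → 𝕌 (V₁ ⊓ V₂) →
            U₁ ⊑ V₁ → U₂ ⊑ V₂ → (U₁ ⊓ U₂) ⊑ (V₁ ⊓ V₂)
  ⇒-mono  : ∀ {U₁ U₂ T₁ T₂} → 𝕋 (U₁ ⇒ T₁) → 𝕋 (U₂ ⇒ T₂) →
            U₂ ⊑ U₁ → T₁ ⊑ T₂ → (U₁ ⇒ T₁) ⊑ (U₂ ⇒ T₂)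
  e-mono  : ∀ {U₁ U₂} i → U₁ ⊑ U₂ → e i U₁ ⊑ e i U₂

-- Environments: partial maps from indexed variables x^L to types
-- (derivable environments always have finite domain, namely fv(M))

Env : Set
Env = ℕ → Idx → Maybe Ty

∅ᴱ : Env
∅ᴱ x L = nothing

[_↦_] : (ℕ × Idx) → Ty → Env
[ (x , L) ↦ U ] y K = if (y =ℕ x) ∧ (K =ᴵ L) then just U else nothing

-- Γ , (x^L : U)   (used only when x^L ∉ dom Γ)
_,,_↦_ : Env → (ℕ × Idx) → Ty → Env
(Γ ,, (x , L) ↦ U) y K = if (y =ℕ x) ∧ (K =ᴵ L) then just U else Γ y K

_⊓ᴱ_ : Env → Env → Env
(Γ₁ ⊓ᴱ Γ₂) x L with Γ₁ x L | Γ₂ x L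
... | just U  | just V  = just (U ⊓ V)
... | just U  | nothing = just U
... | nothing | just V  = just V
... | nothing | nothing = nothing

eᴱ : ℕ → Env → Env
eᴱ j Γ x []      = nothing
eᴱ j Γ x (i ∷ L) = if i =ℕ j then Data.Maybe.map (e j) (Γ x L) else nothing

envω : Tm → Env
envω M x L = if isFree x L M then just (ω L) else nothing

_↾_ : Env → Tm → Env
(Γ ↾ N) x L = if isFree x L N then Γ x L else nothing

_◇ᴱ_ : Env → Env → Set
Γ₁ ◇ᴱ Γ₂ = ∀ x L K → Is-just (Γ₁ x L) → Is-just (Γ₂ x K) → L ≡ K

_⊑ᴱ_ : Env → Env → Set
Γ₁ ⊑ᴱ Γ₂ = ∀ x L → Pointwise _⊑_ (Γ₁ x L) (Γ₂ x L)

-- Typing  Γ ⊢ M ∶ U   (the paper's  M : ⟨Γ ⊢ U⟩)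

data _⊢_∶_ : Env → Tm → Ty → Set where
  ax    : ∀ {x T} → 𝕋 T → [ (x , []) ↦ T ] ⊢ fv x [] ∶ T
  omega : ∀ {M} → 𝓜 M → envω M ⊢ M ∶ ω (d M)
  →I    : ∀ {Γ L M U T} (S : List ℕ) → 𝕋 T →
          (∀ x → x ∉ S → (Γ x L ≡ nothing) ×
                         ((Γ ,, (x , L) ↦ U) ⊢ (M ^ fv x L) ∶ T)) →
          Γ ⊢ lam L M ∶ (U ⇒ T)
  →I′   : ∀ {Γ L M T} (S : List ℕ) → 𝕋 T →
          (∀ x → x ∉ S → (Γ x L ≡ nothing) × (Γ ⊢ (M ^ fv x L) ∶ T)) →
          Γ ⊢ lam L M ∶ (ω L ⇒ T)
  →E    : ∀ {Γ₁ Γ₂ M₁ M₂ U T} → 𝕋 T →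
          Γ₁ ⊢ M₁ ∶ (U ⇒ T) → Γ₂ ⊢ M₂ ∶ U → Γ₁ ◇ᴱ Γ₂ →
          (Γ₁ ⊓ᴱ Γ₂) ⊢ app M₁ M₂ ∶ T
  ⊓I    : ∀ {Γ M U₁ U₂} → deg U₁ ≡ deg U₂ →
          Γ ⊢ M ∶ U₁ → Γ ⊢ M ∶ U₂ → Γ ⊢ M ∶ (U₁ ⊓ U₂)
  expn  : ∀ {Γ M U} j → Γ ⊢ M ∶ U → eᴱ j Γ ⊢ lift j M ∶ e j U
  sub   : ∀ {Γ Γ′ M U U′} → Γ ⊢ M ∶ U → U ⊑ U′ → Γ′ ⊑ᴱ Γ → Γ′ ⊢ M ∶ U′

module Submission where

-- Three
-- lemmas carry the argument: a generation lemma for abstractions, inversion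
-- of expansions (a type of degree j ∷ K types a lifted term, whose unlifting
-- has the stripped type) and the substitution lemma (subst-lemma).  One-step
-- subject reduction (subject-reduction-step) follows by induction on the
-- derivation, each typing rule being one named case; the theorem iterates it
-- along reduction sequences, weak head reduction being a special case of β.

open import Defs
open import Data.Nat using (ℕ; zero; suc; _≟_; _<_; _≤_; s≤s; z≤n)
import Data.Nat.Properties as NP
open import Data.Bool using (Bool; true; false; _∧_; _∨_; if_then_else_)
open import Data.Bool.Properties using (∨-zeroʳ)
open import Data.List using (List; []; _∷_; _++_; length; map)
open import Data.Nat.ListAction using (sum)
open import Data.List.Properties using (≡-dec; ++-assoc; ++-identityʳ; ∷-injectiveˡ)
open import Data.List.Membership.Propositional using (_∈_; _∉_)
open import Data.List.Membership.Propositional.Properties using (∈-++⁺ˡ; ∈-++⁺ʳ; ∈-++⁻)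
open import Data.List.Relation.Unary.Any using (here; there)
open import Data.List.Relation.Binary.Subset.Propositional.Properties using (⊆-reflexive; ⊆-reflexive-↭)
open import Data.List.Relation.Binary.Permutation.Propositional.Properties using (++-comm)
open import Data.Maybe using (Maybe; just; nothing; Is-just)
import Data.Maybe as May
import Data.Maybe.Relation.Unary.Any as MAny
open import Data.Maybe.Relation.Binary.Pointwise using (Pointwise; just; nothing)
open import Data.Product using (Σ; _×_; _,_; proj₁; proj₂)
open import Data.Sum using (_⊎_; inj₁; inj₂; reduce)
open import Data.Empty using (⊥; ⊥-elim)
open import Data.Unit using (⊤; tt)
open import Relation.Nullary using (¬_; Dec; yes; no)
open import Relation.Nullary.Decidable using (⌊_⌋)
open import Relation.Binary.PropositionalEquality
open import Relation.Binary.Construct.Closure.ReflexiveTransitive using (ε; _◅_)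

⌊⌋-true : ∀ {A : Set} (a? : Dec A) → ⌊ a? ⌋ ≡ true → A
⌊⌋-true (yes a) _ = a
⌊⌋-true (no _) ()

⌊⌋-yes : ∀ {A : Set} (a? : Dec A) → A → ⌊ a? ⌋ ≡ true
⌊⌋-yes (yes _) _ = refl
⌊⌋-yes (no ¬a) a = ⊥-elim (¬a a)

⌊⌋-no : ∀ {A : Set} (a? : Dec A) → ¬ A → ⌊ a? ⌋ ≡ false
⌊⌋-no (yes a) ¬a = ⊥-elim (¬a a)
⌊⌋-no (no _) _ = refl

=ℕ-refl : ∀ n → (n =ℕ n) ≡ true
=ℕ-refl n = ⌊⌋-yes (n ≟ n) refl

key : ℕ → Idx → ℕ → Idx → Bool
key y K x L = (y =ℕ x) ∧ (K =ᴵ L)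

key-refl : ∀ x L → key x L x L ≡ true
key-refl x L rewrite =ℕ-refl x | ⌊⌋-yes (≡-dec _≟_ L L) refl = refl

key-false : ∀ {y K x L} → ¬ (y ≡ x × K ≡ L) → key y K x L ≡ false
key-false {y} {K} {x} {L} ne with y =ℕ x in p | K =ᴵ L in q
... | true | true = ⊥-elim (ne (⌊⌋-true (y ≟ x) p , ⌊⌋-true (≡-dec _≟_ K L) q))
... | true | false = refl
... | false | _ = refl

key-case : ∀ x L y K → (x ≡ y × L ≡ K × key x L y K ≡ true) ⊎ (¬ (x ≡ y × L ≡ K) × key x L y K ≡ false)
key-case x L y K with x ≟ y | ≡-dec _≟_ L K
... | yes refl | yes refl = inj₁ (refl , refl , refl)
... | yes _    | no L≢K   = inj₂ ((λ p → L≢K (proj₂ p)) , refl)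
... | no x≢y   | _        = inj₂ ((λ p → x≢y (proj₁ p)) , refl)

ne-fst : ∀ {y z : ℕ} {K L : Idx} → ¬ y ≡ z → ¬ (y ≡ z × K ≡ L)
ne-fst ne (p , _) = ne p

data Fr (x : ℕ) (L : Idx) : Tm → Set where
  fr-v : Fr x L (fv x L)
  fr-l : ∀ {M N} → Fr x L M → Fr x L (app M N)
  fr-r : ∀ {M N} → Fr x L N → Fr x L (app M N)
  fr-λ : ∀ {K M} → Fr x L M → Fr x L (lam K M)

∨-true : ∀ {a b} → (a ∨ b) ≡ true → a ≡ true ⊎ b ≡ true
∨-true {true} _ = inj₁ refl
∨-true {false} q = inj₂ q

isFree→Fr : ∀ {x L} M → isFree x L M ≡ true → Fr x L M
isFree→Fr {x} {L} (fv y K) q with key-case x L y K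
... | inj₁ (refl , refl , _) = fr-v
... | inj₂ (_ , r) with trans (sym r) q
... | ()
isFree→Fr (bv n) ()
isFree→Fr (app M N) q with ∨-true {isFree _ _ M} q
... | inj₁ p = fr-l (isFree→Fr M p)
... | inj₂ p = fr-r (isFree→Fr N p)
isFree→Fr (lam K M) q = fr-λ (isFree→Fr M q)

Fr→isFree : ∀ {x L M} → Fr x L M → isFree x L M ≡ true
Fr→isFree {x} {L} fr-v = key-refl x L
Fr→isFree (fr-l {N = N} f) rewrite Fr→isFree f = refl
Fr→isFree {x} {L} (fr-r {M = M} f) rewrite Fr→isFree f = ∨-zeroʳ (isFree x L M)
Fr→isFree (fr-λ f) = Fr→isFree f

¬Fr→isFree : ∀ {x L} M → ¬ Fr x L M → isFree x L M ≡ false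
¬Fr→isFree {x} {L} M nf with isFree x L M in q
... | true = ⊥-elim (nf (isFree→Fr M q))
... | false = refl

Fr? : ∀ x L M → Dec (Fr x L M)
Fr? x L M with isFree x L M in q
... | true = yes (isFree→Fr M q)
... | false = no (λ f → true≢false (trans (sym (Fr→isFree f)) q))
  where true≢false : true ≡ false → ⊥
        true≢false ()

not-app : ∀ {y K M N} → ¬ Fr y K M → ¬ Fr y K N → ¬ Fr y K (app M N)
not-app a b (fr-l f) = a f
not-app a b (fr-r f) = b f

names : Tm → List ℕ
names (fv x L) = x ∷ []
names (bv n) = []
names (app M N) = names M ++ names N
names (lam L M) = names M

Fr→names : ∀ {x L M} → Fr x L M → x ∈ names M
Fr→names fr-v = here refl
Fr→names (fr-l f) = ∈-++⁺ˡ (Fr→names f)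
Fr→names (fr-r {M = M} f) = ∈-++⁺ʳ (names M) (Fr→names f)
Fr→names (fr-λ f) = Fr→names f

-- A name outside a finite set: one more than the sum of its elements.
∈⇒≤sum : ∀ {x S} → x ∈ S → x ≤ sum S
∈⇒≤sum {S = y ∷ S} (here refl) = NP.m≤m+n y (sum S)
∈⇒≤sum {S = y ∷ S} (there p) = NP.≤-trans (∈⇒≤sum p) (NP.m≤n+m (sum S) y)

fresh : List ℕ → ℕ
fresh S = suc (sum S)

fresh-∉ : ∀ S → fresh S ∉ S
fresh-∉ S p = NP.<-irrefl refl (∈⇒≤sum p)

freshL : ℕ → List ℕ → ℕ
freshL y S = fresh (y ∷ S)

freshL-∉ : ∀ y S → freshL y S ∉ S
freshL-∉ y S p = fresh-∉ (y ∷ S) (there p)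

freshL-≢ : ∀ y S → ¬ y ≡ freshL y S
freshL-≢ y S p = fresh-∉ (y ∷ S) (here (sym p))

∉-++⁻ : ∀ {x : ℕ} A {B} → x ∉ A ++ B → x ∉ A × x ∉ B
∉-++⁻ A x∉ = (λ p → x∉ (∈-++⁺ˡ p)) , (λ p → x∉ (∈-++⁺ʳ A p))

nothing≢just : ∀ {A : Set} {a : A} → ¬ (May.nothing ≡ May.just a)
nothing≢just ()

data Occ : ℕ → Tm → Set where
  oc-b : ∀ {k} → Occ k (bv k)
  oc-l : ∀ {k M N} → Occ k M → Occ k (app M N)
  oc-r : ∀ {k M N} → Occ k N → Occ k (app M N)
  oc-λ : ∀ {k L M} → Occ (suc k) M → Occ k (lam L M)

occ? : ∀ k M → Dec (Occ k M)
occ? k (fv x L) = no λ ()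
occ? k (bv n) with n ≟ k
... | yes refl = yes oc-b
... | no ne = no λ { oc-b → ne refl }
occ? k (app M N) with occ? k M | occ? k N
... | yes p | _ = yes (oc-l p)
... | no _ | yes p = yes (oc-r p)
... | no p | no q = no λ { (oc-l x) → p x ; (oc-r x) → q x }
occ? k (lam L M) with occ? (suc k) M
... | yes p = yes (oc-λ p)
... | no p = no λ { (oc-λ x) → p x }

bv-case : ∀ n k u → (n ≡ k × openAt k u (bv n) ≡ u) ⊎ (¬ n ≡ k × openAt k u (bv n) ≡ bv n)
bv-case n k u with n ≟ k
... | yes refl = inj₁ (refl , refl)
... | no n≢k = inj₂ (n≢k , refl)

open-nocc : ∀ k u M → ¬ Occ k M → openAt k u M ≡ M
open-nocc k u (fv x L) _ = refl
open-nocc k u (bv n) nb with bv-case n k u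
... | inj₁ (refl , _) = ⊥-elim (nb oc-b)
... | inj₂ (_ , p) = p
open-nocc k u (app M N) nb =
  cong₂ app (open-nocc k u M (λ z → nb (oc-l z))) (open-nocc k u N (λ z → nb (oc-r z)))
open-nocc k u (lam L M) nb = cong (lam L) (open-nocc (suc k) u M (λ z → nb (oc-λ z)))

Fr-open⁺ : ∀ {x L} k u M → Fr x L M → Fr x L (openAt k u M)
Fr-open⁺ k u (fv _ _) fr-v = fr-v
Fr-open⁺ k u (app M N) (fr-l f) = fr-l (Fr-open⁺ k u M f)
Fr-open⁺ k u (app M N) (fr-r f) = fr-r (Fr-open⁺ k u N f)
Fr-open⁺ k u (lam K M) (fr-λ f) = fr-λ (Fr-open⁺ (suc k) u M f)

Fr-open-occ : ∀ {x L} k u M → Occ k M → Fr x L u → Fr x L (openAt k u M)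
Fr-open-occ k u (bv k) oc-b f rewrite =ℕ-refl k = f
Fr-open-occ k u (app M N) (oc-l o) f = fr-l (Fr-open-occ k u M o f)
Fr-open-occ k u (app M N) (oc-r o) f = fr-r (Fr-open-occ k u N o f)
Fr-open-occ k u (lam K M) (oc-λ o) f = fr-λ (Fr-open-occ (suc k) u M o f)

Fr-open⁻ : ∀ {x L} k u M → Fr x L (openAt k u M) → Fr x L M ⊎ Fr x L u
Fr-open⁻ k u (fv y K) f = inj₁ f
Fr-open⁻ k u (bv n) f with bv-case n k u
... | inj₁ (_ , p) rewrite p = inj₂ f
... | inj₂ (_ , p) rewrite p with f
... | ()
Fr-open⁻ k u (app M N) (fr-l f) with Fr-open⁻ k u M f
... | inj₁ g = inj₁ (fr-l g)
... | inj₂ g = inj₂ g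
Fr-open⁻ k u (app M N) (fr-r f) with Fr-open⁻ k u N f
... | inj₁ g = inj₁ (fr-r g)
... | inj₂ g = inj₂ g
Fr-open⁻ k u (lam K M) (fr-λ f) with Fr-open⁻ (suc k) u M f
... | inj₁ g = inj₁ (fr-λ g)
... | inj₂ g = inj₂ g

Fr-open⁻occ : ∀ {x L} k u M → Fr x L (openAt k u M) → Fr x L M ⊎ Occ k M
Fr-open⁻occ k u (fv y K) f = inj₁ f
Fr-open⁻occ k u (bv n) f with bv-case n k u
... | inj₁ (refl , _) = inj₂ oc-b
... | inj₂ (_ , p) rewrite p with f
... | ()
Fr-open⁻occ k u (app M N) (fr-l f) with Fr-open⁻occ k u M f
... | inj₁ g = inj₁ (fr-l g)
... | inj₂ g = inj₂ (oc-l g)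
Fr-open⁻occ k u (app M N) (fr-r f) with Fr-open⁻occ k u N f
... | inj₁ g = inj₁ (fr-r g)
... | inj₂ g = inj₂ (oc-r g)
Fr-open⁻occ k u (lam K M) (fr-λ f) with Fr-open⁻occ (suc k) u M f
... | inj₁ g = inj₁ (fr-λ g)
... | inj₂ g = inj₂ (oc-λ g)

Fr-openv⁻ : ∀ {y K x L} k M → Fr y K (openAt k (fv x L) M) → ¬ (y ≡ x × K ≡ L) → Fr y K M
Fr-openv⁻ k M f ne with Fr-open⁻ k _ M f
... | inj₁ g = g
... | inj₂ fr-v = ⊥-elim (ne (refl , refl))

Occ-openv : ∀ {x L} k M → x ∉ names M → Fr x L (openAt k (fv x L) M) → Occ k M
Occ-openv k M xn f with Fr-open⁻occ k _ M f
... | inj₁ g = ⊥-elim (xn (Fr→names g))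
... | inj₂ o = o

-- Local closure: Cl k M says that M has no dangling bound variable under k
-- enclosing binders.  Well-formed terms are locally closed (Cl 0).

data Cl : ℕ → Tm → Set where
  cl-f : ∀ {k x L} → Cl k (fv x L)
  cl-b : ∀ {k n} → n < k → Cl k (bv n)
  cl-a : ∀ {k M N} → Cl k M → Cl k N → Cl k (app M N)
  cl-λ : ∀ {k L M} → Cl (suc k) M → Cl k (lam L M)

Cl-mono : ∀ {k j M} → Cl k M → k ≤ j → Cl j M
Cl-mono cl-f _ = cl-f
Cl-mono (cl-b p) q = cl-b (NP.<-≤-trans p q)
Cl-mono (cl-a a b) q = cl-a (Cl-mono a q) (Cl-mono b q)
Cl-mono (cl-λ a) q = cl-λ (Cl-mono a (s≤s q))

open-cl : ∀ {k j} u M → Cl k M → k ≤ j → openAt j u M ≡ M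
open-cl u (fv _ _) _ _ = refl
open-cl {k} {j} u (bv n) (cl-b p) q with bv-case n j u
... | inj₁ (refl , _) = ⊥-elim (NP.<-irrefl refl (NP.<-≤-trans p q))
... | inj₂ (_ , r) = r
open-cl u (app M N) (cl-a a b) q = cong₂ app (open-cl u M a q) (open-cl u N b q)
open-cl u (lam L M) (cl-λ a) q = cong (lam L) (open-cl u M a (s≤s q))

Cl-open⁻ : ∀ k u M → Cl k (openAt k u M) → Cl (suc k) M
Cl-open⁻ k u (fv _ _) _ = cl-f
Cl-open⁻ k u (bv n) c with bv-case n k u
... | inj₁ (refl , _) = cl-b NP.≤-refl
... | inj₂ (_ , p) rewrite p with c
... | cl-b q = cl-b (NP.m≤n⇒m≤1+n q)
Cl-open⁻ k u (app M N) (cl-a a b) = cl-a (Cl-open⁻ k u M a) (Cl-open⁻ k u N b)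
Cl-open⁻ k u (lam L M) (cl-λ a) = cl-λ (Cl-open⁻ (suc k) u M a)

Cl-open⁺ : ∀ k u M → Cl (suc k) M → Cl 0 u → Cl k (openAt k u M)
Cl-open⁺ k u (fv _ _) _ _ = cl-f
Cl-open⁺ k u (bv n) (cl-b p) cu with bv-case n k u
... | inj₁ (_ , r) rewrite r = Cl-mono cu z≤n
... | inj₂ (ne , r) rewrite r = cl-b (NP.≤∧≢⇒< (NP.≤-pred p) ne)
Cl-open⁺ k u (app M N) (cl-a a b) cu = cl-a (Cl-open⁺ k u M a cu) (Cl-open⁺ k u N b cu)
Cl-open⁺ k u (lam L M) (cl-λ a) cu = cl-λ (Cl-open⁺ (suc k) u M a cu)

substVar : ℕ → Idx → Tm → Tm → Tm
substVar x L N (fv y K) = if key x L y K then N else fv y K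
substVar x L N (bv n) = bv n
substVar x L N (app M P) = app (substVar x L N M) (substVar x L N P)
substVar x L N (lam K M) = lam K (substVar x L N M)

substVar-same : ∀ x L N → substVar x L N (fv x L) ≡ N
substVar-same x L N rewrite key-refl x L = refl

substVar-other : ∀ {x L y K} N → ¬ (x ≡ y × L ≡ K) → substVar x L N (fv y K) ≡ fv y K
substVar-other {x} {L} {y} {K} N ne rewrite key-false {x} {L} {y} {K} ne = refl

substVar-fresh : ∀ {x L} N M → ¬ Fr x L M → substVar x L N M ≡ M
substVar-fresh {x} {L} N (fv y K) nf = substVar-other {x} {L} {y} {K} N λ { (refl , refl) → nf fr-v }
substVar-fresh N (bv n) nf = refl
substVar-fresh N (app M P) nf =
  cong₂ app (substVar-fresh N M (λ z → nf (fr-l z))) (substVar-fresh N P (λ z → nf (fr-r z)))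
substVar-fresh N (lam K M) nf = cong (lam K) (substVar-fresh N M (λ z → nf (fr-λ z)))

substVar-open-var : ∀ {x L} k N M → x ∉ names M → substVar x L N (openAt k (fv x L) M) ≡ openAt k N M
substVar-open-var {x} {L} k N (fv y K) xn = substVar-other {x} {L} {y} {K} N λ { (refl , _) → xn (here refl) }
substVar-open-var {x} {L} k N (bv n) xn with bv-case n k (fv x L) | bv-case n k N
... | inj₁ (_ , p) | inj₁ (_ , q) rewrite p | q = substVar-same x L N
... | inj₁ (r , _) | inj₂ (s , _) = ⊥-elim (s r)
... | inj₂ (r , _) | inj₁ (s , _) = ⊥-elim (r s)
... | inj₂ (_ , p) | inj₂ (_ , q) rewrite p | q = refl
substVar-open-var k N (app M P) xn =
  cong₂ app (substVar-open-var k N M (proj₁ (∉-++⁻ (names M) xn)))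
            (substVar-open-var k N P (proj₂ (∉-++⁻ (names M) xn)))
substVar-open-var k N (lam K M) xn = cong (lam K) (substVar-open-var (suc k) N M xn)

substVar-open-comm : ∀ {x L y K} k N M → ¬ y ≡ x → Cl 0 N →
  substVar x L N (openAt k (fv y K) M) ≡ openAt k (fv y K) (substVar x L N M)
substVar-open-comm {x} {L} {y} {K} k N (fv z J) ne cN with key-case x L z J
... | inj₁ (_ , _ , q) rewrite q = sym (open-cl _ N cN z≤n)
... | inj₂ (_ , q) rewrite q = refl
substVar-open-comm {x} {L} {y} {K} k N (bv n) ne cN with bv-case n k (fv y K)
... | inj₁ (_ , p) rewrite p = substVar-other {x} {L} {y} {K} N λ { (refl , _) → ne refl }
... | inj₂ (_ , p) rewrite p = refl
substVar-open-comm k N (app M P) ne cN = cong₂ app (substVar-open-comm k N M ne cN) (substVar-open-comm k N P ne cN)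
substVar-open-comm k N (lam J M) ne cN = cong (lam J) (substVar-open-comm (suc k) N M ne cN)

Fr-substVar⁻ : ∀ {y K x L} N M → Fr y K (substVar x L N M) → (Fr y K M × ¬ (y ≡ x × K ≡ L)) ⊎ Fr y K N
Fr-substVar⁻ {y} {K} {x} {L} N (fv z J) f with key-case x L z J
... | inj₁ (_ , _ , q) rewrite q = inj₂ f
... | inj₂ (ne , q) rewrite q with f
... | fr-v = inj₁ (fr-v , λ { (refl , refl) → ne (refl , refl) })
Fr-substVar⁻ N (bv n) ()
Fr-substVar⁻ N (app M P) (fr-l f) with Fr-substVar⁻ N M f
... | inj₁ (g , ne) = inj₁ (fr-l g , ne)
... | inj₂ g = inj₂ g
Fr-substVar⁻ N (app M P) (fr-r f) with Fr-substVar⁻ N P f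
... | inj₁ (g , ne) = inj₁ (fr-r g , ne)
... | inj₂ g = inj₂ g
Fr-substVar⁻ N (lam J M) (fr-λ f) with Fr-substVar⁻ N M f
... | inj₁ (g , ne) = inj₁ (fr-λ g , ne)
... | inj₂ g = inj₂ g

Fr-substVar⁺ˡ : ∀ {y K x L} N M → Fr y K M → ¬ (y ≡ x × K ≡ L) → Fr y K (substVar x L N M)
Fr-substVar⁺ˡ {y} {K} {x} {L} N (fv _ _) fr-v ne
  rewrite substVar-other {x} {L} {y} {K} N (λ { (refl , refl) → ne (refl , refl) }) = fr-v
Fr-substVar⁺ˡ N (app M P) (fr-l f) ne = fr-l (Fr-substVar⁺ˡ N M f ne)
Fr-substVar⁺ˡ N (app M P) (fr-r f) ne = fr-r (Fr-substVar⁺ˡ N P f ne)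
Fr-substVar⁺ˡ N (lam J M) (fr-λ f) ne = fr-λ (Fr-substVar⁺ˡ N M f ne)

Fr-substVar⁺ʳ : ∀ {y K x L} N M → Fr x L M → Fr y K N → Fr y K (substVar x L N M)
Fr-substVar⁺ʳ {x = x} {L} N (fv _ _) fr-v g rewrite substVar-same x L N = g
Fr-substVar⁺ʳ N (app M P) (fr-l f) g = fr-l (Fr-substVar⁺ʳ N M f g)
Fr-substVar⁺ʳ N (app M P) (fr-r f) g = fr-r (Fr-substVar⁺ʳ N P f g)
Fr-substVar⁺ʳ N (lam J M) (fr-λ f) g = fr-λ (Fr-substVar⁺ʳ N M f g)

degAt-cl : ∀ {k Δ₁ Δ₂} M → Cl k M → (∀ n → n < k → nthIdx Δ₁ n ≡ nthIdx Δ₂ n) → degAt Δ₁ M ≡ degAt Δ₂ M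
degAt-cl (fv x L) _ _ = refl
degAt-cl (bv n) (cl-b p) h = h n p
degAt-cl (app M N) (cl-a a _) h = degAt-cl M a h
degAt-cl {Δ₁ = Δ₁} {Δ₂} (lam L M) (cl-λ a) h = degAt-cl M a h'
  where h' : ∀ n → n < _ → nthIdx (L ∷ Δ₁) n ≡ nthIdx (L ∷ Δ₂) n
        h' zero _ = refl
        h' (suc n) (s≤s p) = h n p

degAt-closed : ∀ Δ M → Cl 0 M → degAt Δ M ≡ d M
degAt-closed Δ M c = degAt-cl M c λ n ()

nthIdx-snoc : ∀ Δ a n → ¬ n ≡ length Δ → nthIdx (Δ ++ a ∷ []) n ≡ nthIdx Δ n
nthIdx-snoc [] a zero ne = ⊥-elim (ne refl)
nthIdx-snoc [] a (suc n) ne = refl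
nthIdx-snoc (L ∷ Δ) a zero ne = refl
nthIdx-snoc (L ∷ Δ) a (suc n) ne = nthIdx-snoc Δ a n (λ p → ne (cong suc p))

nthIdx-snoc-eq : ∀ Δ a → nthIdx (Δ ++ a ∷ []) (length Δ) ≡ a
nthIdx-snoc-eq [] a = refl
nthIdx-snoc-eq (L ∷ Δ) a = nthIdx-snoc-eq Δ a

degAt-open : ∀ Δ u M → Cl 0 u → degAt Δ (openAt (length Δ) u M) ≡ degAt (Δ ++ d u ∷ []) M
degAt-open Δ u (fv x L) cu = refl
degAt-open Δ u (bv n) cu with bv-case n (length Δ) u
... | inj₁ (refl , p) rewrite p = trans (degAt-closed Δ u cu) (sym (nthIdx-snoc-eq Δ (d u)))
... | inj₂ (ne , p) rewrite p = sym (nthIdx-snoc Δ (d u) n ne)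
degAt-open Δ u (app M N) cu = degAt-open Δ u M cu
degAt-open Δ u (lam L M) cu = degAt-open (L ∷ Δ) u M cu

d-openv : ∀ x L M → d (M ^ fv x L) ≡ degAt (L ∷ []) M
d-openv x L M = degAt-open [] (fv x L) M cl-f

deg-substVar : ∀ {x L} N → Cl 0 N → d N ≡ L → ∀ Δ M → degAt Δ (substVar x L N M) ≡ degAt Δ M
deg-substVar {x} {L} N cN dN Δ (fv y K) with key-case x L y K
... | inj₁ (_ , refl , q) rewrite q = trans (degAt-closed Δ N cN) dN
... | inj₂ (_ , q) rewrite q = refl
deg-substVar N cN dN Δ (bv n) = refl
deg-substVar N cN dN Δ (app M P) = deg-substVar N cN dN Δ M
deg-substVar N cN dN Δ (lam K M) = deg-substVar N cN dN (K ∷ Δ) M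

tl : Idx → Idx
tl [] = []
tl (_ ∷ L) = L

unlift : Tm → Tm
unlift (fv x L) = fv x (tl L)
unlift (bv n) = bv n
unlift (app M N) = app (unlift M) (unlift N)
unlift (lam L M) = lam (tl L) (unlift M)

data Lifted (j : ℕ) : Tm → Set where
  lf-v : ∀ {x L} → Lifted j (fv x (j ∷ L))
  lf-b : ∀ {n} → Lifted j (bv n)
  lf-a : ∀ {M N} → Lifted j M → Lifted j N → Lifted j (app M N)
  lf-λ : ∀ {L M} → Lifted j M → Lifted j (lam (j ∷ L) M)

unlift-lift : ∀ j M → unlift (lift j M) ≡ M
unlift-lift j (fv x L) = refl
unlift-lift j (bv n) = refl
unlift-lift j (app M N) = cong₂ app (unlift-lift j M) (unlift-lift j N)
unlift-lift j (lam L M) = cong (lam L) (unlift-lift j M)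

lift-unlift : ∀ {j M} → Lifted j M → lift j (unlift M) ≡ M
lift-unlift lf-v = refl
lift-unlift lf-b = refl
lift-unlift (lf-a a b) = cong₂ app (lift-unlift a) (lift-unlift b)
lift-unlift (lf-λ a) = cong (lam _) (lift-unlift a)

Lifted-lift : ∀ j M → Lifted j (lift j M)
Lifted-lift j (fv x L) = lf-v
Lifted-lift j (bv n) = lf-b
Lifted-lift j (app M N) = lf-a (Lifted-lift j M) (Lifted-lift j N)
Lifted-lift j (lam L M) = lf-λ (Lifted-lift j M)

unlift-open : ∀ k u M → unlift (openAt k u M) ≡ openAt k (unlift u) (unlift M)
unlift-open k u (fv x L) = refl
unlift-open k u (bv n) with bv-case n k u | bv-case n k (unlift u)
... | inj₁ (_ , p) | inj₁ (_ , q) rewrite p | q = refl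
... | inj₁ (r , _) | inj₂ (s , _) = ⊥-elim (s r)
... | inj₂ (r , _) | inj₁ (s , _) = ⊥-elim (r s)
... | inj₂ (_ , p) | inj₂ (_ , q) rewrite p | q = refl
unlift-open k u (app M N) = cong₂ app (unlift-open k u M) (unlift-open k u N)
unlift-open k u (lam L M) = cong (lam (tl L)) (unlift-open (suc k) u M)

lift-open : ∀ j k u M → lift j (openAt k u M) ≡ openAt k (lift j u) (lift j M)
lift-open j k u (fv x L) = refl
lift-open j k u (bv n) with bv-case n k u | bv-case n k (lift j u)
... | inj₁ (_ , p) | inj₁ (_ , q) rewrite p | q = refl
... | inj₁ (r , _) | inj₂ (s , _) = ⊥-elim (s r)
... | inj₂ (r , _) | inj₁ (s , _) = ⊥-elim (r s)
... | inj₂ (_ , p) | inj₂ (_ , q) rewrite p | q = refl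
lift-open j k u (app M N) = cong₂ app (lift-open j k u M) (lift-open j k u N)
lift-open j k u (lam L M) = cong (lam (j ∷ L)) (lift-open j (suc k) u M)

Lifted-open⁻ : ∀ {j} k u M → Lifted j (openAt k u M) → Lifted j M
Lifted-open⁻ k u (fv x L) l = l
Lifted-open⁻ k u (bv n) l = lf-b
Lifted-open⁻ k u (app M N) (lf-a a b) = lf-a (Lifted-open⁻ k u M a) (Lifted-open⁻ k u N b)
Lifted-open⁻ k u (lam L M) (lf-λ a) = lf-λ (Lifted-open⁻ (suc k) u M a)

Lifted-open⁺ : ∀ {j} k u M → Lifted j M → Lifted j u → Lifted j (openAt k u M)
Lifted-open⁺ k u (fv x L) l _ = l
Lifted-open⁺ k u (bv n) l lu with bv-case n k u
... | inj₁ (_ , p) rewrite p = lu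
... | inj₂ (_ , p) rewrite p = lf-b
Lifted-open⁺ k u (app M N) (lf-a a b) lu = lf-a (Lifted-open⁺ k u M a lu) (Lifted-open⁺ k u N b lu)
Lifted-open⁺ k u (lam _ M) (lf-λ a) lu = lf-λ (Lifted-open⁺ (suc k) u M a lu)

Fr-unlift⁻ : ∀ {j x L M} → Lifted j M → Fr x L (unlift M) → Fr x (j ∷ L) M
Fr-unlift⁻ lf-v fr-v = fr-v
Fr-unlift⁻ (lf-a a b) (fr-l f) = fr-l (Fr-unlift⁻ a f)
Fr-unlift⁻ (lf-a a b) (fr-r f) = fr-r (Fr-unlift⁻ b f)
Fr-unlift⁻ (lf-λ a) (fr-λ f) = fr-λ (Fr-unlift⁻ a f)

Fr-unlift⁺ : ∀ {j x L M} → Fr x (j ∷ L) M → Fr x L (unlift M)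
Fr-unlift⁺ fr-v = fr-v
Fr-unlift⁺ (fr-l f) = fr-l (Fr-unlift⁺ f)
Fr-unlift⁺ (fr-r f) = fr-r (Fr-unlift⁺ f)
Fr-unlift⁺ (fr-λ f) = fr-λ (Fr-unlift⁺ f)

Fr-Lifted : ∀ {j x L M} → Lifted j M → Fr x L M → Σ Idx λ L' → L ≡ j ∷ L'
Fr-Lifted lf-v fr-v = _ , refl
Fr-Lifted (lf-a a b) (fr-l f) = Fr-Lifted a f
Fr-Lifted (lf-a a b) (fr-r f) = Fr-Lifted b f
Fr-Lifted (lf-λ a) (fr-λ f) = Fr-Lifted a f

Fr-lift : ∀ {j x L} M → Fr x L M → Fr x (j ∷ L) (lift j M)
Fr-lift _ fr-v = fr-v
Fr-lift (app M N) (fr-l f) = fr-l (Fr-lift M f)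
Fr-lift (app M N) (fr-r f) = fr-r (Fr-lift N f)
Fr-lift (lam K M) (fr-λ f) = fr-λ (Fr-lift M f)

Fr-lift⁻ : ∀ {j x L} M → Fr x (j ∷ L) (lift j M) → Fr x L M
Fr-lift⁻ {j} M f with Fr-unlift⁺ {j} f
... | g rewrite unlift-lift j M = g

key-lift : ∀ x L y K j → key x (j ∷ L) y (j ∷ K) ≡ key x L y K
key-lift x L y K j with key-case x L y K | key-case x (j ∷ L) y (j ∷ K)
... | inj₁ (_ , _ , p) | inj₁ (_ , _ , q) rewrite p | q = refl
... | inj₁ (a , b , _) | inj₂ (ne , _) = ⊥-elim (ne (a , cong (j ∷_) b))
... | inj₂ (ne , _) | inj₁ (a , b , _) = ⊥-elim (ne (a , cong tl b))
... | inj₂ (_ , p) | inj₂ (_ , q) rewrite p | q = refl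

lift-substVar : ∀ j x L N M → lift j (substVar x L N M) ≡ substVar x (j ∷ L) (lift j N) (lift j M)
lift-substVar j x L N (fv y K) rewrite key-lift x L y K j with key x L y K
... | true = refl
... | false = refl
lift-substVar j x L N (bv n) = refl
lift-substVar j x L N (app M P) = cong₂ app (lift-substVar j x L N M) (lift-substVar j x L N P)
lift-substVar j x L N (lam K M) = cong (lam (j ∷ K)) (lift-substVar j x L N M)

nth-tl : ∀ Δ n → nthIdx (map tl Δ) n ≡ tl (nthIdx Δ n)
nth-tl [] n = refl
nth-tl (L ∷ Δ) zero = refl
nth-tl (L ∷ Δ) (suc n) = nth-tl Δ n

deg-unlift : ∀ Δ M → degAt (map tl Δ) (unlift M) ≡ tl (degAt Δ M)
deg-unlift Δ (fv x L) = refl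
deg-unlift Δ (bv n) = nth-tl Δ n
deg-unlift Δ (app M N) = deg-unlift Δ M
deg-unlift Δ (lam L M) = deg-unlift (L ∷ Δ) M

d-unlift : ∀ M → d (unlift M) ≡ tl (d M)
d-unlift M = deg-unlift [] M

𝓜-cl : ∀ {M} → 𝓜 M → Cl 0 M
𝓜-cl (var x L) = cl-f
𝓜-cl (app a b _ _) = cl-a (𝓜-cl a) (𝓜-cl b)
𝓜-cl {lam L B} (lam S f) =
  cl-λ (Cl-open⁻ 0 (fv (fresh S) L) B (𝓜-cl (proj₁ (f (fresh S) (fresh-∉ S)))))

⪯-trans : ∀ {A B C} → A ⪯ B → B ⪯ C → A ⪯ C
⪯-trans {A} (X , refl) (Y , refl) = X ++ Y , ++-assoc A X Y

⪯-refl : ∀ {A} → A ⪯ A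
⪯-refl {A} = [] , sym (++-identityʳ A)

tl-⪯ : ∀ {A B} → A ⪯ B → tl A ⪯ tl B
tl-⪯ {[]} _ = _ , refl
tl-⪯ {a ∷ A} (X , refl) = X , refl

data Ext (D : Idx) : Tm → Set where
  ex-v : ∀ {x L} → D ⪯ L → Ext D (fv x L)
  ex-b : ∀ {n} → Ext D (bv n)
  ex-a : ∀ {M N} → Ext D M → Ext D N → Ext D (app M N)
  ex-λ : ∀ {L M} → D ⪯ L → Ext D M → Ext D (lam L M)

Ext-mono : ∀ {D D' M} → D' ⪯ D → Ext D M → Ext D' M
Ext-mono p (ex-v q) = ex-v (⪯-trans p q)
Ext-mono p ex-b = ex-b
Ext-mono p (ex-a a b) = ex-a (Ext-mono p a) (Ext-mono p b)
Ext-mono p (ex-λ q a) = ex-λ (⪯-trans p q) (Ext-mono p a)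

Ext-open⁻ : ∀ {D} k u M → Ext D (openAt k u M) → Ext D M
Ext-open⁻ k u (fv x L) a = a
Ext-open⁻ k u (bv n) a = ex-b
Ext-open⁻ k u (app M N) (ex-a a b) = ex-a (Ext-open⁻ k u M a) (Ext-open⁻ k u N b)
Ext-open⁻ k u (lam L M) (ex-λ p a) = ex-λ p (Ext-open⁻ (suc k) u M a)

𝓜-ext : ∀ {M} → 𝓜 M → Ext (d M) M
𝓜-ext (var x L) = ex-v ⪯-refl
𝓜-ext (app a b p _) = ex-a (𝓜-ext a) (Ext-mono p (𝓜-ext b))
𝓜-ext {lam L B} (lam S f) with f (fresh S) (fresh-∉ S)
... | m , p = ex-λ (subst (_⪯ L) q p)
                   (Ext-open⁻ 0 (fv (fresh S) L) B (subst (λ D → Ext D (B ^ fv (fresh S) L)) q (𝓜-ext m)))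
  where q : d (B ^ fv (fresh S) L) ≡ degAt (L ∷ []) B
        q = d-openv (fresh S) L B

Ext→Lifted : ∀ {j K M} → Ext (j ∷ K) M → Lifted j M
Ext→Lifted (ex-v (X , refl)) = lf-v
Ext→Lifted ex-b = lf-b
Ext→Lifted (ex-a a b) = lf-a (Ext→Lifted a) (Ext→Lifted b)
Ext→Lifted (ex-λ (X , refl) a) = lf-λ (Ext→Lifted a)

𝓜-Lifted : ∀ {N j K} → 𝓜 N → d N ≡ j ∷ K → Lifted j N
𝓜-Lifted {N} m p = Ext→Lifted (subst (λ D → Ext D N) p (𝓜-ext m))

Join : Tm → Tm → Set
Join M N = ∀ {x L K} → Fr x L M → Fr x K N → L ≡ K

◇→Join : ∀ {M N} → M ◇ N → Join M N
◇→Join j {x} {L} {K} f g = j x L K (Fr→isFree f) (Fr→isFree g)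

Join→◇ : ∀ {M N} → Join M N → M ◇ N
Join→◇ {M} {N} j x L K f g = j (isFree→Fr M f) (isFree→Fr N g)

𝓜-self : ∀ {N} → 𝓜 N → Join N N
𝓜-self (var x L) fr-v fr-v = refl
𝓜-self (app a b _ jn) (fr-l f) (fr-l g) = 𝓜-self a f g
𝓜-self (app a b _ jn) (fr-l f) (fr-r g) = ◇→Join jn f g
𝓜-self (app a b _ jn) (fr-r f) (fr-l g) = sym (◇→Join jn g f)
𝓜-self (app a b _ jn) (fr-r f) (fr-r g) = 𝓜-self b f g
𝓜-self {lam L B} (lam S f) (fr-λ g) (fr-λ h) =
  𝓜-self (proj₁ (f (fresh S) (fresh-∉ S))) (Fr-open⁺ 0 _ B g) (Fr-open⁺ 0 _ B h)

𝓜-unlift : ∀ {j N} → 𝓜 N → Lifted j N → 𝓜 (unlift N)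
𝓜-unlift (var x L) _ = var x (tl L)
𝓜-unlift {N = app M N} (app a b p jn) (lf-a la lb) =
  app (𝓜-unlift a la) (𝓜-unlift b lb)
      (subst₂ _⪯_ (sym (d-unlift M)) (sym (d-unlift N)) (tl-⪯ p))
      (Join→◇ λ f g → cong tl (◇→Join jn (Fr-unlift⁻ la f) (Fr-unlift⁻ lb g)))
𝓜-unlift {j} {lam (j ∷ L') B} (lam S f) (lf-λ lb) = lam S h
  where
    h : ∀ x → x ∉ S → 𝓜 (unlift B ^ fv x L') × d (unlift B ^ fv x L') ⪯ L'
    h x xn with f x xn
    ... | m , p rewrite sym (unlift-open 0 (fv x (j ∷ L')) B) =
      𝓜-unlift m (Lifted-open⁺ 0 _ B lb lf-v) ,
      subst (_⪯ L') (sym (d-unlift (B ^ fv x (j ∷ L')))) (tl-⪯ p)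

▷β-unlift : ∀ {j M M'} → Lifted j M → M ▷β M' → Lifted j M' × (unlift M ▷β unlift M')
▷β-unlift {j} (lf-a (lf-λ {L} {B} lb) ln) (beta {N = N} dN) =
  Lifted-open⁺ 0 N B lb ln ,
  subst (unlift (app (lam (j ∷ L) B) N) ▷β_) (sym (unlift-open 0 N B))
        (beta (trans (d-unlift N) (cong tl dN)))
▷β-unlift (lf-a la lb) (appˡ r) with ▷β-unlift la r
... | la' , r' = lf-a la' lb , appˡ r'
▷β-unlift (lf-a la lb) (appʳ r) with ▷β-unlift lb r
... | lb' , r' = lf-a la lb' , appʳ r'
▷β-unlift {j} (lf-λ {L} {B} lb) (lam {M′ = B'} S f) =
  lf-λ (Lifted-open⁻ 0 (fv (fresh S) (j ∷ L)) B'
         (proj₁ (▷β-unlift (Lifted-open⁺ 0 _ B lb lf-v) (f (fresh S) (fresh-∉ S))))) ,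
  lam S λ x xn → subst₂ _▷β_ (unlift-open 0 (fv x (j ∷ L)) B) (unlift-open 0 (fv x (j ∷ L)) B')
                   (proj₂ (▷β-unlift (Lifted-open⁺ 0 _ B lb lf-v) (f x xn)))

Fr-▷β : ∀ {M M' x L} → M ▷β M' → Fr x L M' → Fr x L M
Fr-▷β (beta {L} {B} {N} _) f with Fr-open⁻ 0 N B f
... | inj₁ g = fr-l (fr-λ g)
... | inj₂ g = fr-r g
Fr-▷β (appˡ r) (fr-l f) = fr-l (Fr-▷β r f)
Fr-▷β (appˡ r) (fr-r f) = fr-r f
Fr-▷β (appʳ r) (fr-l f) = fr-l f
Fr-▷β (appʳ r) (fr-r f) = fr-r (Fr-▷β r f)
Fr-▷β {x = x} (lam {L} {B} {B'} S f) (fr-λ g) =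
  fr-λ (Fr-openv⁻ 0 B (Fr-▷β (f (freshL x S) (freshL-∉ x S)) (Fr-open⁺ 0 _ B' g)) (ne-fst (freshL-≢ x S)))

deg-▷β : ∀ {M M'} → Cl 0 M → M ▷β M' → d M' ≡ d M
deg-▷β (cl-a (cl-λ cB) cN) (beta {L} {B} {N} dN) =
  trans (degAt-open [] N B cN) (cong (λ K → degAt (K ∷ []) B) dN)
deg-▷β (cl-a a b) (appˡ r) = deg-▷β a r
deg-▷β (cl-a a b) (appʳ r) = refl
deg-▷β (cl-λ cB) (lam {L} {B} {B'} S f) =
  let x = fresh S in
  trans (sym (d-openv x L B'))
        (trans (deg-▷β (Cl-open⁺ 0 (fv x L) B cB cl-f) (f x (fresh-∉ S))) (d-openv x L B))

▷h⇒▷β : ∀ {M M'} → M ▷h M' → M ▷β M'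
▷h⇒▷β (beta p) = beta p
▷h⇒▷β (appˡ r) = appˡ (▷h⇒▷β r)

deg-≈ : ∀ {U V} → U ≈ V → deg U ≡ deg V
deg-≈ ≈-refl = refl
deg-≈ (≈-sym p) = sym (deg-≈ p)
deg-≈ (≈-trans p q) = trans (deg-≈ p) (deg-≈ q)
deg-≈ (⇒-cong p q) = refl
deg-≈ (⊓-cong p q) = deg-≈ p
deg-≈ (e-cong i p) = cong (i ∷_) (deg-≈ p)
deg-≈ (⊓-comm p) = p
deg-≈ (⊓-assoc p q) = refl
deg-≈ ⊓-idem = refl
deg-≈ (e-⊓ i p) = refl
deg-≈ (ω-unit p) = sym p
deg-≈ (e-ω i K) = refl

deg-⊑ : ∀ {U V} → U ⊑ V → deg U ≡ deg V
deg-⊑ (⊑-refl p) = deg-≈ p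
deg-⊑ (⊑-trans p q) = trans (deg-⊑ p) (deg-⊑ q)
deg-⊑ (⊓-elim _) = refl
deg-⊑ (⊓-mono _ _ p q) = deg-⊑ p
deg-⊑ (⇒-mono _ _ _ _) = refl
deg-⊑ (e-mono i p) = cong (i ∷_) (deg-⊑ p)

deg-𝕋 : ∀ {T} → 𝕋 T → deg T ≡ []
deg-𝕋 (atom a) = refl
deg-𝕋 (arr _ _) = refl

⊑-id : ∀ {U} → U ⊑ U
⊑-id = ⊑-refl ≈-refl

_⊑∘_ : ∀ {U V W} → U ⊑ V → V ⊑ W → U ⊑ W
_⊑∘_ = ⊑-trans

strip : Ty → Ty
strip (atom a) = atom a
strip (U ⇒ T) = U ⇒ T
strip (ω L) = ω (tl L)
strip (U ⊓ V) = strip U ⊓ strip V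
strip (e i U) = U

deg-strip : ∀ U → deg (strip U) ≡ tl (deg U)
deg-strip (atom a) = refl
deg-strip (U ⇒ T) = refl
deg-strip (ω L) = refl
deg-strip (U ⊓ V) = deg-strip U
deg-strip (e i U) = refl

strip-deg-eq : ∀ U V → deg U ≡ deg V → deg (strip U) ≡ deg (strip V)
strip-deg-eq U V p = trans (deg-strip U) (trans (cong tl p) (sym (deg-strip V)))

strip-≈ : ∀ {U V} → U ≈ V → strip U ≈ strip V
strip-≈ ≈-refl = ≈-refl
strip-≈ (≈-sym p) = ≈-sym (strip-≈ p)
strip-≈ (≈-trans p q) = ≈-trans (strip-≈ p) (strip-≈ q)
strip-≈ (⇒-cong p q) = ⇒-cong p q
strip-≈ (⊓-cong p q) = ⊓-cong (strip-≈ p) (strip-≈ q)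
strip-≈ (e-cong i p) = p
strip-≈ (⊓-comm {U} {V} p) = ⊓-comm (strip-deg-eq U V p)
strip-≈ (⊓-assoc {U} {V} {W} p q) = ⊓-assoc (strip-deg-eq U V p) (strip-deg-eq V W q)
strip-≈ ⊓-idem = ⊓-idem
strip-≈ (e-⊓ i p) = ≈-refl
strip-≈ (ω-unit {L} {U} p) = ω-unit (trans (deg-strip U) (cong tl p))
strip-≈ (e-ω i K) = ≈-refl

strip-𝕌 : ∀ {U i K} → 𝕌 U → deg U ≡ i ∷ K → 𝕌 (strip U)
strip-𝕌 (ty t) p with trans (sym (deg-𝕋 t)) p
... | ()
strip-𝕌 (omega L) p = omega (tl L)
strip-𝕌 (inter {U} {V} u v q) p = inter (strip-𝕌 u p) (strip-𝕌 v (trans (sym q) p)) (strip-deg-eq U V q)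
strip-𝕌 (expn i u) p = u

strip-⊑ : ∀ {U V i K} → U ⊑ V → deg V ≡ i ∷ K → strip U ⊑ strip V
strip-⊑ (⊑-refl p) _ = ⊑-refl (strip-≈ p)
strip-⊑ (⊑-trans p q) r = ⊑-trans (strip-⊑ p (trans (deg-⊑ q) r)) (strip-⊑ q r)
strip-⊑ (⊓-elim u) r = ⊓-elim (strip-𝕌 u r)
strip-⊑ (⊓-mono u v p q) r with v
... | inter _ _ dv = ⊓-mono (strip-𝕌 u (trans (deg-⊑ p) r)) (strip-𝕌 v r) (strip-⊑ p r) (strip-⊑ q (trans (sym dv) r))
strip-⊑ (⇒-mono _ _ _ _) ()
strip-⊑ (e-mono i p) _ = p

-- Good types are those equivalent to a well-formed type.  All types in a
-- derivation are good (env-ok below), and for them ⊓ is a meet and ω is top.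

Good : Ty → Set
Good U = Σ Ty λ W → 𝕌 W × U ≈ W

Good-𝕌 : ∀ {U} → 𝕌 U → Good U
Good-𝕌 u = _ , u , ≈-refl

Good-≈ : ∀ {U V} → U ≈ V → Good V → Good U
Good-≈ p (W , w , q) = W , w , ≈-trans p q

Good-⊓ : ∀ {U V} → Good U → Good V → deg U ≡ deg V → Good (U ⊓ V)
Good-⊓ (U' , u , p) (V' , v , q) r =
  (U' ⊓ V') , inter u v (trans (sym (deg-≈ p)) (trans r (deg-≈ q))) , ⊓-cong p q

Good-e : ∀ {U} j → Good U → Good (e j U)
Good-e j (U' , u , p) = e j U' , expn j u , e-cong j p

Good-⊑ : ∀ {U V} → U ⊑ V → Good V → Good U
Good-⊑ (⊑-refl p) g = Good-≈ p g
Good-⊑ (⊑-trans p q) g = Good-⊑ p (Good-⊑ q g)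
Good-⊑ (⊓-elim u) _ = Good-𝕌 u
Good-⊑ (⊓-mono u _ _ _) _ = Good-𝕌 u
Good-⊑ (⇒-mono t _ _ _) _ = Good-𝕌 (ty t)
Good-⊑ (e-mono i p) (W , w , q) =
  Good-e i (Good-⊑ p (strip W , strip-𝕌 w (sym (deg-≈ q)) , strip-≈ q))

⊓-elimˡ-Good : ∀ {U V} → Good U → Good V → deg U ≡ deg V → (U ⊓ V) ⊑ U
⊓-elimˡ-Good (U' , u , p) (V' , v , q) r =
  ⊑-refl (⊓-cong p q) ⊑∘ (⊓-elim (inter u v (trans (sym (deg-≈ p)) (trans r (deg-≈ q)))) ⊑∘ ⊑-refl (≈-sym p))

⊓-elimʳ-Good : ∀ {U V} → Good U → Good V → deg U ≡ deg V → (U ⊓ V) ⊑ V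
⊓-elimʳ-Good gu gv r = ⊑-refl (⊓-comm r) ⊑∘ ⊓-elimˡ-Good gv gu (sym r)

⊓-mono-Good : ∀ {U₁ U₂ V₁ V₂} → Good U₁ → Good U₂ → Good V₁ → Good V₂ →
  deg U₁ ≡ deg U₂ → deg V₁ ≡ deg V₂ → U₁ ⊑ V₁ → U₂ ⊑ V₂ → (U₁ ⊓ U₂) ⊑ (V₁ ⊓ V₂)
⊓-mono-Good (A , a , pa) (B , b , pb) (C , c , pc) (D , dd , pd) r s p q =
  ⊑-refl (⊓-cong pa pb) ⊑∘
  (⊓-mono (inter a b (trans (sym (deg-≈ pa)) (trans r (deg-≈ pb))))
          (inter c dd (trans (sym (deg-≈ pc)) (trans s (deg-≈ pd))))
          (⊑-refl (≈-sym pa) ⊑∘ (p ⊑∘ ⊑-refl pc))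
          (⊑-refl (≈-sym pb) ⊑∘ (q ⊑∘ ⊑-refl pd))
   ⊑∘ ⊑-refl (⊓-cong (≈-sym pc) (≈-sym pd)))

ω-top : ∀ {U} → Good U → U ⊑ ω (deg U)
ω-top {U} (W , w , p) =
  ⊑-refl (≈-trans p (≈-sym (ω-unit {deg U} (sym (deg-≈ p))))) ⊑∘
  ⊓-elim (inter (omega (deg U)) w (deg-≈ p))

𝕌-e-strip : ∀ {U j K} → 𝕌 U → deg U ≡ j ∷ K → U ≈ e j (strip U)
𝕌-e-strip (ty t) p with trans (sym (deg-𝕋 t)) p
... | ()
𝕌-e-strip (omega (i ∷ L)) refl = ≈-sym (e-ω i L)
𝕌-e-strip (expn i u) refl = ≈-refl
𝕌-e-strip {j = j} (inter {U} {V} u v q) p =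
  ≈-trans (⊓-cong (𝕌-e-strip u p) (𝕌-e-strip v (trans (sym q) p)))
          (≈-sym (e-⊓ j (strip-deg-eq U V q)))

Good-e-strip : ∀ {U j K} → Good U → deg U ≡ j ∷ K → U ≈ e j (strip U)
Good-e-strip {j = j} (W , w , p) r =
  ≈-trans p (≈-trans (𝕌-e-strip w (trans (sym (deg-≈ p)) r)) (e-cong j (strip-≈ (≈-sym p))))

OfDeg : Idx → Ty → Set
OfDeg K X = Good X × deg X ≡ K

OfDeg-⊓ : ∀ {K A B} → OfDeg K A → OfDeg K B → OfDeg K (A ⊓ B)
OfDeg-⊓ (ga , da) (gb , db) = Good-⊓ ga gb (trans da (sym db)) , da

⊓-lowerˡ : ∀ {K A B} → OfDeg K A → OfDeg K B → (A ⊓ B) ⊑ A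
⊓-lowerˡ (ga , da) (gb , db) = ⊓-elimˡ-Good ga gb (trans da (sym db))

⊓-lowerʳ : ∀ {K A B} → OfDeg K A → OfDeg K B → (A ⊓ B) ⊑ B
⊓-lowerʳ (ga , da) (gb , db) = ⊓-elimʳ-Good ga gb (trans da (sym db))

⊓-mono-OfDeg : ∀ {K A B A' B'} → OfDeg K A → OfDeg K B → OfDeg K A' → OfDeg K B' → A ⊑ A' →
  B ⊑ B' → (A ⊓ B) ⊑ (A' ⊓ B')
⊓-mono-OfDeg (ga , da) (gb , db) (ga' , da') (gb' , db') p q =
  ⊓-mono-Good ga gb ga' gb' (trans da (sym db)) (trans da' (sym db')) p q

⊓-greatest : ∀ {K X Y Z} → OfDeg K X → OfDeg K Y → OfDeg K Z → X ⊑ Y → X ⊑ Z → X ⊑ (Y ⊓ Z)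
⊓-greatest gx gy gz p q = ⊑-refl (≈-sym ⊓-idem) ⊑∘ ⊓-mono-OfDeg gx gx gy gz p q

-- Arrow components of a type.  If U ⊑ V, every arrow component of V is
-- covered by one of U (contravariantly in the argument); this drives the
-- generation lemma for abstractions.

arrows : Ty → List (Ty × Ty)
arrows (atom a) = []
arrows (U ⇒ T) = (U , T) ∷ []
arrows (ω L) = []
arrows (U ⊓ V) = arrows U ++ arrows V
arrows (e i U) = []

ArrowCover′ : Ty → Ty → Set
ArrowCover′ V W = ∀ {U T} → (U , T) ∈ arrows W →
                Σ Ty λ U' → Σ Ty λ T' → ((U' , T') ∈ arrows V) × (U ⊑ U') × (T' ⊑ T)

record ArrowCover (V W : Ty) : Set where
  constructor mkCover
  field cover : ArrowCover′ V W
open ArrowCover public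

cover-⊆ : ∀ {V W} → (∀ {p} → p ∈ arrows W → p ∈ arrows V) → ArrowCover V W
cover-⊆ f = mkCover λ {U} {T} m → U , T , f m , ⊑-id , ⊑-id

cover-trans : ∀ {U V W} → ArrowCover U V → ArrowCover V W → ArrowCover U W
cover-trans {U} {V} {W} f g = mkCover h
  where
    h : ArrowCover′ U W
    h m with cover g m
    ... | U1 , T1 , m1 , a , b with cover f m1
    ... | U2 , T2 , m2 , c , dd = U2 , T2 , m2 , a ⊑∘ c , dd ⊑∘ b

cover-⊓ : ∀ {U U' V V'} → ArrowCover U U' → ArrowCover V V' → ArrowCover (U ⊓ V) (U' ⊓ V')
cover-⊓ {U} {U'} {V} {V'} f g = mkCover h
  where
    h : ArrowCover′ (U ⊓ V) (U' ⊓ V')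
    h m with ∈-++⁻ (arrows U') m
    ... | inj₁ m' with cover f m'
    ... | a , b , m'' , c , dd = a , b , ∈-++⁺ˡ m'' , c , dd
    h m | inj₂ m' with cover g m'
    ... | a , b , m'' , c , dd = a , b , ∈-++⁺ʳ (arrows U) m'' , c , dd

cover-refl : ∀ {U} → ArrowCover U U
cover-refl = cover-⊆ (λ m → m)

cover-none : ∀ {V W} → arrows W ≡ [] → ArrowCover V W
cover-none {V} {W} p = mkCover h
  where h : ArrowCover′ V W
        h m rewrite p with m
        ... | ()

≈⇒cover : ∀ {U V} → U ≈ V → ArrowCover U V × ArrowCover V U
≈⇒cover ≈-refl = cover-refl , cover-refl
≈⇒cover (≈-sym p) = proj₂ (≈⇒cover p) , proj₁ (≈⇒cover p)
≈⇒cover (≈-trans p q) =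
  cover-trans (proj₁ (≈⇒cover p)) (proj₁ (≈⇒cover q)) , cover-trans (proj₂ (≈⇒cover q)) (proj₂ (≈⇒cover p))
≈⇒cover (⇒-cong {U} {U'} {T} {T'} p q) = mkCover f , mkCover g
  where f : ArrowCover′ (U ⇒ T) (U' ⇒ T')
        f (here refl) = U , T , here refl , ⊑-refl (≈-sym p) , ⊑-refl q
        f (there ())
        g : ArrowCover′ (U' ⇒ T') (U ⇒ T)
        g (here refl) = U' , T' , here refl , ⊑-refl p , ⊑-refl (≈-sym q)
        g (there ())
≈⇒cover (⊓-cong p q) =
  cover-⊓ (proj₁ (≈⇒cover p)) (proj₁ (≈⇒cover q)) , cover-⊓ (proj₂ (≈⇒cover p)) (proj₂ (≈⇒cover q))
≈⇒cover (e-cong i p) = cover-none refl , cover-none refl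
≈⇒cover (⊓-comm {U} {V} p) =
  cover-⊆ (⊆-reflexive-↭ (++-comm (arrows V) (arrows U))) , cover-⊆ (⊆-reflexive-↭ (++-comm (arrows U) (arrows V)))
≈⇒cover (⊓-assoc {U} {V} {W} p q) =
  cover-⊆ (⊆-reflexive (sym (++-assoc (arrows U) (arrows V) (arrows W)))) ,
  cover-⊆ (⊆-reflexive (++-assoc (arrows U) (arrows V) (arrows W)))
≈⇒cover (⊓-idem {U}) = cover-⊆ ∈-++⁺ˡ , cover-⊆ (λ m → reduce (∈-++⁻ (arrows U) m))
≈⇒cover (e-⊓ i p) = cover-none refl , cover-none refl
≈⇒cover (ω-unit p) = cover-⊆ (λ m → m) , cover-⊆ (λ m → m)
≈⇒cover (e-ω i K) = cover-none refl , cover-none refl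

⊑⇒cover : ∀ {U V} → U ⊑ V → ArrowCover U V
⊑⇒cover (⊑-refl p) = proj₁ (≈⇒cover p)
⊑⇒cover (⊑-trans p q) = cover-trans (⊑⇒cover p) (⊑⇒cover q)
⊑⇒cover (⊓-elim _) = cover-⊆ ∈-++⁺ˡ
⊑⇒cover (⊓-mono _ _ p q) = cover-⊓ (⊑⇒cover p) (⊑⇒cover q)
⊑⇒cover (⇒-mono {U₁} {U₂} {T₁} {T₂} _ _ p q) = mkCover f
  where f : ArrowCover′ (U₁ ⇒ T₁) (U₂ ⇒ T₂)
        f (here refl) = U₁ , T₁ , here refl , p , q
        f (there ())
⊑⇒cover (e-mono i p) = cover-none refl

_⊓ᴹ_ : Maybe Ty → Maybe Ty → Maybe Ty
just U ⊓ᴹ just V = just (U ⊓ V)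
just U ⊓ᴹ nothing = just U
nothing ⊓ᴹ m = m

⊓ᴱ-≡ : ∀ Γ₁ Γ₂ x L → (Γ₁ ⊓ᴱ Γ₂) x L ≡ (Γ₁ x L ⊓ᴹ Γ₂ x L)
⊓ᴱ-≡ Γ₁ Γ₂ x L with Γ₁ x L | Γ₂ x L
... | just U | just V = refl
... | just U | nothing = refl
... | nothing | just V = refl
... | nothing | nothing = refl

↾-yes : ∀ {x L N} Γ → Fr x L N → (Γ ↾ N) x L ≡ Γ x L
↾-yes {x} {L} {N} Γ f rewrite Fr→isFree f = refl

↾-no : ∀ {x L N} Γ → ¬ Fr x L N → (Γ ↾ N) x L ≡ nothing
↾-no {x} {L} {N} Γ nf rewrite ¬Fr→isFree N nf = refl

↾-nothing : ∀ Γ N {y K} → Γ y K ≡ nothing → (Γ ↾ N) y K ≡ nothing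
↾-nothing Γ N {y} {K} p with isFree y K N
... | true = p
... | false = refl

↾-just : ∀ Γ N {y K A} → (Γ ↾ N) y K ≡ just A → Γ y K ≡ just A
↾-just Γ N {y} {K} p with isFree y K N
... | true = p
↾-just Γ N {y} {K} () | false

↾-cong : ∀ {Γ Γ′ z K} N → Γ z K ≡ Γ′ z K → (Γ ↾ N) z K ≡ (Γ′ ↾ N) z K
↾-cong {z = z} {K} N p = cong (λ m → if isFree z K N then m else nothing) p

↾-lam-open : ∀ Γ {y L B' z K} → ¬ (z ≡ y × K ≡ L) → (Γ ↾ lam L B') z K ≡ (Γ ↾ (B' ^ fv y L)) z K
↾-lam-open Γ {y} {L} {B'} {z} {K} ne with Fr? z K B'
... | yes f = trans (↾-yes {N = lam L B'} Γ (fr-λ f)) (sym (↾-yes Γ (Fr-open⁺ 0 (fv y L) B' f)))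
... | no nf = trans (↾-no {N = lam L B'} Γ (λ { (fr-λ g) → nf g }))
                   (sym (↾-no {N = B' ^ fv y L} Γ (λ g → nf (Fr-openv⁻ 0 B' g ne))))

envω-yes : ∀ {x L M} → Fr x L M → envω M x L ≡ just (ω L)
envω-yes f rewrite Fr→isFree f = refl

envω-no : ∀ {x L M} → ¬ Fr x L M → envω M x L ≡ nothing
envω-no {M = M} nf rewrite ¬Fr→isFree M nf = refl

,,-here : ∀ Γ x L U → (Γ ,, (x , L) ↦ U) x L ≡ just U
,,-here Γ x L U rewrite key-refl x L = refl

,,-there : ∀ Γ {x L U y K} → ¬ (y ≡ x × K ≡ L) → (Γ ,, (x , L) ↦ U) y K ≡ Γ y K
,,-there Γ {x} {L} {U} {y} {K} ne rewrite key-false {y} {K} {x} {L} ne = refl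

single-case : ∀ x L T y K →
  (y ≡ x × K ≡ L × [ (x , L) ↦ T ] y K ≡ just T) ⊎ (¬ (y ≡ x × K ≡ L) × [ (x , L) ↦ T ] y K ≡ nothing)
single-case x L T y K with key-case y K x L
... | inj₁ (a , b , q) rewrite q = inj₁ (a , b , refl)
... | inj₂ (ne , q) rewrite q = inj₂ (ne , refl)

eᴱ-cases : ∀ j Γ x K → (eᴱ j Γ x K ≡ nothing) ⊎ (Σ Idx λ K' →
  K ≡ j ∷ K' × eᴱ j Γ x K ≡ May.map (e j) (Γ x K'))
eᴱ-cases j Γ x [] = inj₁ refl
eᴱ-cases j Γ x (i ∷ K') with i =ℕ j in q
... | true = inj₂ (K' , cong (_∷ K') (⌊⌋-true (_ ≟ j) q) , refl)
... | false = inj₁ refl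

eᴱ-same : ∀ j Γ x K → eᴱ j Γ x (j ∷ K) ≡ May.map (e j) (Γ x K)
eᴱ-same j Γ x K rewrite =ℕ-refl j = refl

eᴱ-other : ∀ j Γ y {i} K → ¬ i ≡ j → eᴱ j Γ y (i ∷ K) ≡ nothing
eᴱ-other j Γ y {i} K ne rewrite ⌊⌋-no (i ≟ j) ne = refl

map-just : ∀ {f : Ty → Ty} m {U} → May.map f m ≡ just U → Σ Ty λ V → m ≡ just V × U ≡ f V
map-just (just V) refl = V , refl , refl
map-just nothing ()

unliftᴱ : ℕ → Env → Env
unliftᴱ j Γ x L = May.map strip (Γ x (j ∷ L))

remove : ℕ → Idx → Env → Env
remove x L Γ y K = if key y K x L then nothing else Γ y K

remove-there : ∀ {x L} Γ {y K} → ¬ (y ≡ x × K ≡ L) → remove x L Γ y K ≡ Γ y K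
remove-there {x} {L} Γ {y} {K} ne rewrite key-false {y} {K} {x} {L} ne = refl

remove-case : ∀ x L Γ y K →
  (y ≡ x × K ≡ L × remove x L Γ y K ≡ nothing) ⊎ (¬ (y ≡ x × K ≡ L) × remove x L Γ y K ≡ Γ y K)
remove-case x L Γ y K with key-case y K x L
... | inj₁ (a , b , q) rewrite q = inj₁ (a , b , refl)
... | inj₂ (ne , q) rewrite q = inj₂ (ne , refl)

remove-nothing : ∀ x L Γ {y K} → Γ y K ≡ nothing → remove x L Γ y K ≡ nothing
remove-nothing x L Γ {y} {K} p with remove-case x L Γ y K
... | inj₁ (_ , _ , q) = q
... | inj₂ (_ , q) = trans q p

remove-noop : ∀ x L Γ → Γ x L ≡ nothing → ∀ y K → remove x L Γ y K ≡ Γ y K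
remove-noop x L Γ p y K with remove-case x L Γ y K
... | inj₁ (refl , refl , q) = trans q (sym p)
... | inj₂ (_ , q) = q

remove-cong : ∀ x L {Γ Γ' y K} → Γ y K ≡ Γ' y K → remove x L Γ y K ≡ remove x L Γ' y K
remove-cong x L {y = y} {K} p = cong (λ m → if key y K x L then nothing else m) p

remove-⊓ : ∀ x L Γ₁ Γ₂ y K → remove x L (Γ₁ ⊓ᴱ Γ₂) y K ≡ (remove x L Γ₁ y K ⊓ᴹ remove x L Γ₂ y K)
remove-⊓ x L Γ₁ Γ₂ y K with key y K x L
... | true = refl
... | false = ⊓ᴱ-≡ Γ₁ Γ₂ y K

remove-just : ∀ x L Γ {y K A} → remove x L Γ y K ≡ just A → Γ y K ≡ just A
remove-just x L Γ {y} {K} p with remove-case x L Γ y K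
... | inj₁ (_ , _ , q) with trans (sym q) p
... | ()
remove-just x L Γ {y} {K} p | inj₂ (_ , q) = trans (sym q) p

remove-single : ∀ x L T y K → remove x L [ (x , L) ↦ T ] y K ≡ nothing
remove-single x L T y K with key y K x L
... | true = refl
... | false = refl

remove-eᴱ : ∀ x L' j Δ y K → remove x (j ∷ L') (eᴱ j Δ) y (j ∷ K) ≡ May.map (e j) (remove x L' Δ y K)
remove-eᴱ x L' j Δ y K rewrite key-lift y K x L' j | eᴱ-same j Δ y K with key y K x L'
... | true = refl
... | false = refl

remove-,, : ∀ x L Γ U → Γ x L ≡ nothing → ∀ y K → remove x L (Γ ,, (x , L) ↦ U) y K ≡ Γ y K
remove-,, x L Γ U p y K with remove-case x L (Γ ,, (x , L) ↦ U) y K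
... | inj₁ (refl , refl , r) = trans r (sym p)
... | inj₂ (ne , r) = trans r (,,-there Γ ne)

PW : Maybe Ty → Maybe Ty → Set
PW = Pointwise _⊑_

pw-refl : ∀ m → PW m m
pw-refl (just U) = just ⊑-id
pw-refl nothing = nothing

pw-≡ : ∀ {a a' b b'} → a ≡ a' → b ≡ b' → PW a' b' → PW a b
pw-≡ refl refl p = p

pw-just : ∀ {m U} → PW m (just U) → Σ Ty λ V → m ≡ just V × V ⊑ U
pw-just (just p) = _ , refl , p

pw-just′ : ∀ {m U} → PW (just U) m → Σ Ty λ V → m ≡ just V × U ⊑ V
pw-just′ (just p) = _ , refl , p

pw-nothing : ∀ {m} → PW m nothing → m ≡ nothing
pw-nothing nothing = refl

subᴱ : ∀ {Γ Γ' M U} → Γ' ⊑ᴱ Γ → Γ ⊢ M ∶ U → Γ' ⊢ M ∶ U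
subᴱ pw D = sub D ⊑-id pw

sub-≅ : ∀ {Γ Γ' M U} → (∀ x L → Γ' x L ≡ Γ x L) → Γ ⊢ M ∶ U → Γ' ⊢ M ∶ U
sub-≅ {Γ} h D = subᴱ (λ x L → pw-≡ (h x L) refl (pw-refl (Γ x L))) D

subᵀ : ∀ {Γ M U U′} → Γ ⊢ M ∶ U → U ⊑ U′ → Γ ⊢ M ∶ U′
subᵀ {Γ} D p = sub D p (λ x L → pw-refl (Γ x L))

pw-ext : ∀ {Γ Γ' x L U U'} → Γ' ⊑ᴱ Γ → U ⊑ U' → (Γ' ,, (x , L) ↦ U) ⊑ᴱ (Γ ,, (x , L) ↦ U')
pw-ext {x = x} {L} pw p y K with key y K x L
... | true = just p
... | false = pw y K

declared⇒Fr : ∀ {Γ M V} → Γ ⊢ M ∶ V → ∀ {x L U} → Γ x L ≡ just U → Fr x L M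
declared⇒Fr (ax {x} {T} t) {y} {K} q with single-case x [] T y K
... | inj₁ (refl , refl , _) = fr-v
... | inj₂ (_ , r) with trans (sym r) q
... | ()
declared⇒Fr (omega {M} m) {x} {L} q with isFree x L M in r
... | true = isFree→Fr M r
declared⇒Fr (omega {M} m) {x} {L} () | false
declared⇒Fr (→I {Γ} {L} {M} S t prem) {y} {K} q =
  let z = freshL y S in
  fr-λ (Fr-openv⁻ 0 M (declared⇒Fr (proj₂ (prem z (freshL-∉ y S))) (trans (,,-there Γ (ne-fst (freshL-≢ y S))) q))
                 (ne-fst (freshL-≢ y S)))
declared⇒Fr (→I′ {Γ} {L} {M} S t prem) {y} {K} q =
  let z = freshL y S in
  fr-λ (Fr-openv⁻ 0 M (declared⇒Fr (proj₂ (prem z (freshL-∉ y S))) q) (ne-fst (freshL-≢ y S)))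
declared⇒Fr (→E {Γ₁} {Γ₂} t D₁ D₂ j) {x} {L} q with Γ₁ x L in q1 | Γ₂ x L in q2 | trans (sym (⊓ᴱ-≡ Γ₁ Γ₂ x L)) q
... | just _ | _ | _ = fr-l (declared⇒Fr D₁ q1)
... | nothing | just _ | _ = fr-r (declared⇒Fr D₂ q2)
... | nothing | nothing | ()
declared⇒Fr (⊓I _ D _) q = declared⇒Fr D q
declared⇒Fr (expn {Γ} {M} j D) {x} {L} q with eᴱ-cases j Γ x L
... | inj₁ r with trans (sym r) q
... | ()
declared⇒Fr (expn {Γ} {M} j D) {x} {L} q | inj₂ (K' , refl , r) with map-just (Γ x K') (trans (sym r) q)
... | V , s , _ = Fr-lift M (declared⇒Fr D s)
declared⇒Fr (sub {Γ} {Γ'} D _ pw) {x} {L} q with pw x L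
... | p rewrite q with pw-just′ p
... | _ , s , _ = declared⇒Fr D s

Fr⇒declared : ∀ {Γ M V} → Γ ⊢ M ∶ V → ∀ {x L} → Fr x L M → Σ Ty λ U → Γ x L ≡ just U
Fr⇒declared (ax {x} {T} t) fr-v with single-case x [] T x []
... | inj₁ (_ , _ , r) = T , r
... | inj₂ (ne , _) = ⊥-elim (ne (refl , refl))
Fr⇒declared (omega m) f = _ , envω-yes f
Fr⇒declared (→I {Γ} {L} {M} S t prem) {y} {K} (fr-λ f) =
  let z = freshL y S in
  let U , q = Fr⇒declared (proj₂ (prem z (freshL-∉ y S))) (Fr-open⁺ 0 (fv z L) M f) in
  U , trans (sym (,,-there Γ (ne-fst (freshL-≢ y S)))) q
Fr⇒declared (→I′ {Γ} {L} {M} S t prem) {y} {K} (fr-λ f) =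
  Fr⇒declared (proj₂ (prem (freshL y S) (freshL-∉ y S))) (Fr-open⁺ 0 _ M f)
Fr⇒declared (→E {Γ₁} {Γ₂} t D₁ D₂ j) {x} {L} (fr-l f) with Fr⇒declared D₁ f
... | U , q rewrite ⊓ᴱ-≡ Γ₁ Γ₂ x L | q with Γ₂ x L
... | just V = _ , refl
... | nothing = _ , refl
Fr⇒declared (→E {Γ₁} {Γ₂} t D₁ D₂ j) {x} {L} (fr-r f) with Fr⇒declared D₂ f
... | U , q rewrite ⊓ᴱ-≡ Γ₁ Γ₂ x L | q with Γ₁ x L
... | just V = _ , refl
... | nothing = _ , refl
Fr⇒declared (⊓I _ D _) f = Fr⇒declared D f
Fr⇒declared (expn {Γ} {M} j D) {x} {L} f with Fr-Lifted (Lifted-lift j M) f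
... | K , refl with Fr⇒declared D (Fr-lift⁻ M f)
... | U , q rewrite eᴱ-same j Γ x K | q = _ , refl
Fr⇒declared (sub {Γ} {Γ'} D _ pw) {x} {L} f with Fr⇒declared D f
... | U , q with pw x L
... | p rewrite q with pw-just p
... | V , s , _ = V , s

¬Fr⇒undeclared : ∀ {Γ M V} → Γ ⊢ M ∶ V → ∀ {x L} → ¬ Fr x L M → Γ x L ≡ nothing
¬Fr⇒undeclared {Γ} D {x} {L} nf with Γ x L in q
... | just U = ⊥-elim (nf (declared⇒Fr D q))
... | nothing = refl

DeclOk : Idx → Maybe Ty → Set
DeclOk L nothing = ⊤
DeclOk L (just U) = OfDeg L U

DeclOk-≡ : ∀ {L a b} → a ≡ b → DeclOk L b → DeclOk L a
DeclOk-≡ refl o = o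

DeclOk-⊓ᴹ : ∀ {L} a b → DeclOk L a → DeclOk L b → DeclOk L (a ⊓ᴹ b)
DeclOk-⊓ᴹ (just U) (just V) (gu , du) (gv , dv) = Good-⊓ gu gv (trans du (sym dv)) , du
DeclOk-⊓ᴹ (just U) nothing o _ = o
DeclOk-⊓ᴹ nothing b _ o = o

DeclOk-remove : ∀ x L Γ y K → DeclOk K (Γ y K) → DeclOk K (remove x L Γ y K)
DeclOk-remove x L Γ y K o with key y K x L
... | true = tt
... | false = o

env-ok : ∀ {Γ M V} → Γ ⊢ M ∶ V → ∀ x L → DeclOk L (Γ x L)
env-ok (ax {x} {T} t) y K with single-case x [] T y K
... | inj₁ (_ , refl , r) = DeclOk-≡ r (Good-𝕌 (ty t) , deg-𝕋 t)
... | inj₂ (_ , r) = DeclOk-≡ r tt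
env-ok (omega {M} m) x L with isFree x L M
... | true = Good-𝕌 (omega L) , refl
... | false = tt
env-ok (→I {Γ} {L} {M} S t prem) y K =
  DeclOk-≡ (sym (,,-there Γ (ne-fst (freshL-≢ y S)))) (env-ok (proj₂ (prem (freshL y S) (freshL-∉ y S))) y K)
env-ok (→I′ S t prem) y K = env-ok (proj₂ (prem (freshL y S) (freshL-∉ y S))) y K
env-ok (→E {Γ₁} {Γ₂} t D₁ D₂ j) x L =
  DeclOk-≡ (⊓ᴱ-≡ Γ₁ Γ₂ x L) (DeclOk-⊓ᴹ (Γ₁ x L) (Γ₂ x L) (env-ok D₁ x L) (env-ok D₂ x L))
env-ok (⊓I _ D _) x L = env-ok D x L
env-ok (expn {Γ} j D) x L with eᴱ-cases j Γ x L
... | inj₁ r = DeclOk-≡ r tt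
... | inj₂ (K' , refl , r) = DeclOk-≡ r (h (Γ x K') (env-ok D x K'))
  where h : ∀ m → DeclOk K' m → DeclOk (j ∷ K') (May.map (e j) m)
        h (just U) (g , dg) = Good-e j g , cong (j ∷_) dg
        h nothing _ = tt
env-ok (sub {Γ} {Γ'} D _ pw) x L = h (pw x L) (env-ok D x L)
  where h : ∀ {a b} → PW a b → DeclOk L b → DeclOk L a
        h (just p) (g , dg) = Good-⊑ p g , trans (deg-⊑ p) dg
        h nothing _ = tt

decl-ok : ∀ {Γ M V} → Γ ⊢ M ∶ V → ∀ {x L U} → Γ x L ≡ just U → OfDeg L U
decl-ok D {x} {L} q = DeclOk-≡ (sym q) (env-ok D x L)

-- (a ⊓ b) ⊓ c ⊑ (a ⊓ c) ⊓ (b ⊓ c): splitting N's environment over an application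
⊓ᴹ-distribʳ : ∀ {K} a b c → DeclOk K a → DeclOk K b → DeclOk K c → PW ((a ⊓ᴹ b) ⊓ᴹ c) ((a ⊓ᴹ c) ⊓ᴹ (b ⊓ᴹ c))
⊓ᴹ-distribʳ (just A) (just B) (just C) ga gb gc =
  just (⊓-greatest (OfDeg-⊓ (OfDeg-⊓ ga gb) gc) (OfDeg-⊓ ga gc) (OfDeg-⊓ gb gc)
                   (⊓-mono-OfDeg (OfDeg-⊓ ga gb) gc ga gc (⊓-lowerˡ ga gb) ⊑-id)
                   (⊓-mono-OfDeg (OfDeg-⊓ ga gb) gc gb gc (⊓-lowerʳ ga gb) ⊑-id))
⊓ᴹ-distribʳ (just A) (just B) nothing ga gb gc = just ⊑-id
⊓ᴹ-distribʳ (just A) nothing (just C) ga gb gc =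
  just (⊓-greatest (OfDeg-⊓ ga gc) (OfDeg-⊓ ga gc) gc ⊑-id (⊓-lowerʳ ga gc))
⊓ᴹ-distribʳ (just A) nothing nothing ga gb gc = just ⊑-id
⊓ᴹ-distribʳ nothing (just B) (just C) ga gb gc =
  just (⊓-greatest (OfDeg-⊓ gb gc) gc (OfDeg-⊓ gb gc) (⊓-lowerʳ gb gc) ⊑-id)
⊓ᴹ-distribʳ nothing (just B) nothing ga gb gc = just ⊑-id
⊓ᴹ-distribʳ nothing nothing (just C) ga gb gc = just (⊓-greatest gc gc gc ⊑-id ⊑-id)
⊓ᴹ-distribʳ nothing nothing nothing ga gb gc = nothing

⊓ᴹ-swap : ∀ {K} a b c → DeclOk K a → DeclOk K b → DeclOk K c → PW ((a ⊓ᴹ b) ⊓ᴹ c) ((a ⊓ᴹ c) ⊓ᴹ b)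
⊓ᴹ-swap (just A) (just B) (just C) ga gb gc =
  just (⊓-greatest (OfDeg-⊓ (OfDeg-⊓ ga gb) gc) (OfDeg-⊓ ga gc) gb
                   (⊓-mono-OfDeg (OfDeg-⊓ ga gb) gc ga gc (⊓-lowerˡ ga gb) ⊑-id)
                   (⊓-lowerˡ (OfDeg-⊓ ga gb) gc ⊑∘ ⊓-lowerʳ ga gb))
⊓ᴹ-swap (just A) (just B) nothing ga gb gc = just ⊑-id
⊓ᴹ-swap (just A) nothing (just C) ga gb gc = just ⊑-id
⊓ᴹ-swap (just A) nothing nothing ga gb gc = just ⊑-id
⊓ᴹ-swap nothing (just B) (just C) ga gb gc = just (⊓-greatest (OfDeg-⊓ gb gc) gc gb (⊓-lowerʳ gb gc) (⊓-lowerˡ gb gc))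
⊓ᴹ-swap nothing (just B) nothing ga gb gc = just ⊑-id
⊓ᴹ-swap nothing nothing (just C) ga gb gc = just ⊑-id
⊓ᴹ-swap nothing nothing nothing ga gb gc = nothing

⊓ᴹ-assoc : ∀ {K} a b c → DeclOk K a → DeclOk K b → DeclOk K c → PW ((a ⊓ᴹ b) ⊓ᴹ c) (a ⊓ᴹ (b ⊓ᴹ c))
⊓ᴹ-assoc (just A) (just B) (just C) ga gb gc =
  just (⊓-greatest (OfDeg-⊓ (OfDeg-⊓ ga gb) gc) ga (OfDeg-⊓ gb gc)
                   (⊓-lowerˡ (OfDeg-⊓ ga gb) gc ⊑∘ ⊓-lowerˡ ga gb)
                   (⊓-mono-OfDeg (OfDeg-⊓ ga gb) gc gb gc (⊓-lowerʳ ga gb) ⊑-id))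
⊓ᴹ-assoc (just A) (just B) nothing ga gb gc = just ⊑-id
⊓ᴹ-assoc (just A) nothing (just C) ga gb gc = just ⊑-id
⊓ᴹ-assoc (just A) nothing nothing ga gb gc = just ⊑-id
⊓ᴹ-assoc nothing (just B) (just C) ga gb gc = just ⊑-id
⊓ᴹ-assoc nothing (just B) nothing ga gb gc = just ⊑-id
⊓ᴹ-assoc nothing nothing (just C) ga gb gc = just ⊑-id
⊓ᴹ-assoc nothing nothing nothing ga gb gc = nothing

⊓ᴹ-monoˡ : ∀ {K} a a₀ c → PW a a₀ → DeclOk K a → DeclOk K a₀ → DeclOk K c → PW (a ⊓ᴹ c) (a₀ ⊓ᴹ c)
⊓ᴹ-monoˡ (just A) (just A₀) (just C) (just p) ga ga₀ gc = just (⊓-mono-OfDeg ga gc ga₀ gc p ⊑-id)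
⊓ᴹ-monoˡ (just A) (just A₀) nothing (just p) ga ga₀ gc = just p
⊓ᴹ-monoˡ nothing nothing c nothing ga ga₀ gc = pw-refl c

⊓ᴹ-expand : ∀ {j K} a c → DeclOk K a → DeclOk (j ∷ K) c →
  PW (May.map (e j) a ⊓ᴹ c) (May.map (e j) (a ⊓ᴹ May.map strip c))
⊓ᴹ-expand {j} (just A) (just C) (ga , da) (gc , dc) =
  just (⊑-refl (≈-trans (⊓-cong ≈-refl (Good-e-strip gc dc))
                        (≈-sym (e-⊓ j (trans da (sym (trans (deg-strip C) (cong tl dc))))))))
⊓ᴹ-expand (just A) nothing _ _ = just ⊑-id
⊓ᴹ-expand nothing (just C) _ (gc , dc) = just (⊑-refl (Good-e-strip gc dc))
⊓ᴹ-expand nothing nothing _ _ = nothing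

⊓ᴹ-lowerˡ : ∀ {K} {A} c → DeclOk K (just A) → DeclOk K c → PW (just A ⊓ᴹ c) (just A)
⊓ᴹ-lowerˡ (just C) ga gc = just (⊓-lowerˡ ga gc)
⊓ᴹ-lowerˡ nothing ga gc = just ⊑-id

⊓ᴹ-lowerʳ : ∀ {K} a {C} → DeclOk K a → DeclOk K (just C) → PW (a ⊓ᴹ just C) (just C)
⊓ᴹ-lowerʳ (just A) ga gc = just (⊓-lowerʳ ga gc)
⊓ᴹ-lowerʳ nothing ga gc = just ⊑-id

⊑ω-decl : ∀ {K} m → DeclOk K m → ¬ m ≡ nothing → PW m (just (ω K))
⊑ω-decl (just X) (g , refl) _ = just (ω-top g)
⊑ω-decl nothing _ ne = ⊥-elim (ne refl)

⊓ᴹ-declaredˡ : ∀ a b {A} → a ≡ just A → ¬ (a ⊓ᴹ b ≡ nothing)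
⊓ᴹ-declaredˡ (just _) (just _) _ ()
⊓ᴹ-declaredˡ (just _) nothing _ ()

⊓ᴹ-declaredʳ : ∀ a b {B} → b ≡ just B → ¬ (a ⊓ᴹ b ≡ nothing)
⊓ᴹ-declaredʳ (just _) (just _) _ ()
⊓ᴹ-declaredʳ nothing (just _) _ ()

record EJ (Γ Δ : Env) : Set where
  constructor mkEJ
  field runEJ : ∀ {y K K' A B} → Γ y K ≡ just A → Δ y K' ≡ just B → K ≡ K'
open EJ public

EJ-sym : ∀ {Γ Δ} → EJ Γ Δ → EJ Δ Γ
EJ-sym ej = mkEJ λ a b → sym (runEJ ej b a)

⊓-split : ∀ Γ₁ Γ₂ {y K C} → (Γ₁ ⊓ᴱ Γ₂) y K ≡ just C → (Σ Ty λ A → Γ₁ y K ≡ just A) ⊎ (Σ Ty λ B →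
  Γ₂ y K ≡ just B)
⊓-split Γ₁ Γ₂ {y} {K} p with Γ₁ y K | Γ₂ y K | trans (sym (⊓ᴱ-≡ Γ₁ Γ₂ y K)) p
... | just A | _ | _ = inj₁ (A , refl)
... | nothing | just B | _ = inj₂ (B , refl)
... | nothing | nothing | ()

⊓-inj₁ : ∀ Γ₁ Γ₂ {y K A} → Γ₁ y K ≡ just A → Σ Ty λ C → (Γ₁ ⊓ᴱ Γ₂) y K ≡ just C
⊓-inj₁ Γ₁ Γ₂ {y} {K} p rewrite ⊓ᴱ-≡ Γ₁ Γ₂ y K | p with Γ₂ y K
... | just B = _ , refl
... | nothing = _ , refl

⊓-inj₂ : ∀ Γ₁ Γ₂ {y K B} → Γ₂ y K ≡ just B → Σ Ty λ C → (Γ₁ ⊓ᴱ Γ₂) y K ≡ just C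
⊓-inj₂ Γ₁ Γ₂ {y} {K} p rewrite ⊓ᴱ-≡ Γ₁ Γ₂ y K | p with Γ₁ y K
... | just B = _ , refl
... | nothing = _ , refl

EJ-⊓ : ∀ {A B C} → EJ A C → EJ B C → EJ (A ⊓ᴱ B) C
EJ-⊓ {A} {B} {C} ea eb = mkEJ h
  where h : ∀ {y K K' X Y} → (A ⊓ᴱ B) y K ≡ just X → C y K' ≡ just Y → K ≡ K'
        h p q with ⊓-split A B p
        ... | inj₁ (_ , p') = runEJ ea p' q
        ... | inj₂ (_ , p') = runEJ eb p' q

EJ-⊓′ : ∀ {A B C} → EJ C A → EJ C B → EJ C (A ⊓ᴱ B)
EJ-⊓′ ea eb = EJ-sym (EJ-⊓ (EJ-sym ea) (EJ-sym eb))

EJ-remove : ∀ {x L A C} → EJ A C → EJ (remove x L A) C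
EJ-remove {x} {L} {A} ea = mkEJ λ p q → runEJ ea (remove-just x L A p) q

EJ-remove′ : ∀ {x L A C} → EJ C A → EJ C (remove x L A)
EJ-remove′ ea = EJ-sym (EJ-remove (EJ-sym ea))

EJ-⊓ˡ : ∀ {A B C} → EJ (A ⊓ᴱ B) C → EJ A C
EJ-⊓ˡ {A} {B} ej0 = mkEJ λ p q → runEJ ej0 (proj₂ (⊓-inj₁ A B p)) q

EJ-⊓ʳ : ∀ {A B C} → EJ (A ⊓ᴱ B) C → EJ B C
EJ-⊓ʳ {A} {B} ej0 = mkEJ λ p q → runEJ ej0 (proj₂ (⊓-inj₂ A B p)) q

EJ-↾ : ∀ {A C N} → EJ A C → EJ (A ↾ N) C
EJ-↾ {A} {C} {N} ea = mkEJ λ p q → runEJ ea (↾-just A N p) q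

EJ-↾′ : ∀ {A C N} → EJ C A → EJ C (A ↾ N)
EJ-↾′ {A} {C} {N} ea = EJ-sym (EJ-↾ {A} {C} {N} (EJ-sym ea))

EJ-,, : ∀ {Δ Γ y L U} → EJ Δ Γ → (∀ K → Γ y K ≡ nothing) → EJ (Δ ,, (y , L) ↦ U) Γ
EJ-,, {Δ} {Γ} {y} {L} {U} ej Γy = mkEJ h
  where h : ∀ {z K K′ A B} → (Δ ,, (y , L) ↦ U) z K ≡ just A → Γ z K′ ≡ just B → K ≡ K′
        h {z} {K} {K′} a b with key-case z K y L
        ... | inj₁ (refl , refl , _) = ⊥-elim (nothing≢just (trans (sym (Γy K′)) b))
        ... | inj₂ (ne , _) = runEJ ej (trans (sym (,,-there Δ ne)) a) b

Is-just⇒just : ∀ {m : Maybe Ty} → Is-just m → Σ Ty λ A → m ≡ just A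
Is-just⇒just (MAny.just {x = A} _) = A , refl

EJ→◇ᴱ : ∀ {Γ Δ} → EJ Γ Δ → Γ ◇ᴱ Δ
EJ→◇ᴱ ej x L K a b = runEJ ej (proj₂ (Is-just⇒just a)) (proj₂ (Is-just⇒just b))

◇ᴱ→EJ : ∀ {Γ Δ} → Γ ◇ᴱ Δ → EJ Γ Δ
◇ᴱ→EJ {Γ} {Δ} j = mkEJ λ {y} {K} {K'} a b →
  j y K K' (subst Is-just (sym a) (MAny.just tt)) (subst Is-just (sym b) (MAny.just tt))

EJ-self : ∀ {Γ N W} → Γ ⊢ N ∶ W → 𝓜 N → EJ Γ Γ
EJ-self D m = mkEJ λ a b → 𝓜-self m (declared⇒Fr D a) (declared⇒Fr D b)

LamPremise : Env → Idx → Tm → Ty → Ty → Set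
LamPremise Γ L B U T =
  (Σ (List ℕ) λ S → ∀ x → x ∉ S → (Γ x L ≡ nothing) × ((Γ ,, (x , L) ↦ U) ⊢ (B ^ fv x L) ∶ T))
  ⊎ ((U ⊑ ω L) × Σ (List ℕ) λ S → ∀ x → x ∉ S → (Γ x L ≡ nothing) × (Γ ⊢ (B ^ fv x L) ∶ T))

lam-generation : ∀ {Γ P V} → Γ ⊢ P ∶ V → ∀ {L B} → P ≡ lam L B → ∀ {U T} → (U , T) ∈ arrows V →
  LamPremise Γ L B U T
lam-generation (ax t) () m
lam-generation (omega _) q ()
lam-generation (→I S t prem) refl (here refl) = inj₁ (S , prem)
lam-generation (→I S t prem) refl (there ())
lam-generation (→I′ S t prem) refl (here refl) = inj₂ (⊑-id , S , prem)
lam-generation (→I′ S t prem) refl (there ())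
lam-generation (→E t D₁ D₂ j) () m
lam-generation (⊓I {U₁ = U₁} _ D₁ D₂) q m with ∈-++⁻ (arrows U₁) m
... | inj₁ m' = lam-generation D₁ q m'
... | inj₂ m' = lam-generation D₂ q m'
lam-generation (expn j D) q ()
lam-generation (sub {Γ} {Γ'} D p pw) {L} q m with cover (⊑⇒cover p) m
... | U' , T' , m' , pU , pT with lam-generation D q m'
... | inj₁ (S , f) = inj₁ (S , λ x xn →
        pw-nothing (subst (PW (Γ' x L)) (proj₁ (f x xn)) (pw x L)) ,
        sub (proj₂ (f x xn)) pT (pw-ext pw pU))
... | inj₂ (ω⊑ , S , f) = inj₂ (pU ⊑∘ ω⊑ , S , λ x xn →
        pw-nothing (subst (PW (Γ' x L)) (proj₁ (f x xn)) (pw x L)) ,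
        sub (proj₂ (f x xn)) pT pw)

unliftᴱ-envω : ∀ {j N} → Lifted j N → ∀ x L → unliftᴱ j (envω N) x L ≡ envω (unlift N) x L
unliftᴱ-envω {j} {N} lN x L with Fr? x L (unlift N)
... | yes f rewrite envω-yes f | envω-yes {x} {j ∷ L} {N} (Fr-unlift⁻ lN f) = refl
... | no nf rewrite envω-no nf | envω-no {x} {j ∷ L} {N} (λ g → nf (Fr-unlift⁺ g)) = refl

unliftᴱ-eᴱ : ∀ j Γ x L → unliftᴱ j (eᴱ j Γ) x L ≡ Γ x L
unliftᴱ-eᴱ j Γ x L rewrite eᴱ-same j Γ x L with Γ x L
... | just U = refl
... | nothing = refl

expansion-inversion : ∀ {Γ N W} → Γ ⊢ N ∶ W → ∀ {j K} → deg W ≡ j ∷ K →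
  Lifted j N × (unliftᴱ j Γ ⊢ unlift N ∶ strip W)
expansion-inversion (ax t) q with trans (sym (deg-𝕋 t)) q
... | ()
expansion-inversion (omega {N} m) {j} q =
  let lN = 𝓜-Lifted m q in
  lN , sub-≅ (unliftᴱ-envω lN)
             (subst (λ D → envω (unlift N) ⊢ unlift N ∶ ω D) (d-unlift N) (omega (𝓜-unlift m lN)))
expansion-inversion (→I S t prem) ()
expansion-inversion (→I′ S t prem) ()
expansion-inversion (→E t D₁ D₂ j) q with trans (sym (deg-𝕋 t)) q
... | ()
expansion-inversion (⊓I {U₁ = U₁} {U₂} p D₁ D₂) q
  with expansion-inversion D₁ q | expansion-inversion D₂ (trans (sym p) q)
... | l , D₁' | _ , D₂' = l , ⊓I (strip-deg-eq U₁ U₂ p) D₁' D₂'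
expansion-inversion (expn {Γ} {N} j D) refl =
  Lifted-lift j N , subst (λ Q → unliftᴱ j (eᴱ j Γ) ⊢ Q ∶ _) (sym (unlift-lift j N)) (sub-≅ (unliftᴱ-eᴱ j Γ) D)
expansion-inversion (sub {Γ} {Γ'} D p pw) {j} q with expansion-inversion D (trans (deg-⊑ p) q)
... | l , D' = l , sub D' (strip-⊑ p q) pw'
  where
    pw' : ∀ x L → PW (unliftᴱ j Γ' x L) (unliftᴱ j Γ x L)
    pw' x L with Γ' x (j ∷ L) | Γ x (j ∷ L) in r | pw x (j ∷ L)
    ... | just _ | just U | just s = just (strip-⊑ s (proj₂ (decl-ok D r)))
    ... | nothing | nothing | nothing = nothing

env-unlift-⊑ : ∀ {Γ N W j} → Γ ⊢ N ∶ W → Lifted j N → Γ ⊑ᴱ eᴱ j (unliftᴱ j Γ)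
env-unlift-⊑ {j = j} D lN x [] = pw-≡ (¬Fr⇒undeclared D (λ f → nil≢cons (proj₂ (Fr-Lifted lN f)))) refl nothing
  where nil≢cons : ∀ {L} → ¬ ([] ≡ j ∷ L)
        nil≢cons ()
env-unlift-⊑ {Γ} {j = j} D lN x (i ∷ L) = at-index i (i ≟ j)
  where
    at-index : ∀ i → Dec (i ≡ j) → PW (Γ x (i ∷ L)) (eᴱ j (unliftᴱ j Γ) x (i ∷ L))
    at-index i (no i≢j) =
      pw-≡ (¬Fr⇒undeclared D (λ f → i≢j (∷-injectiveˡ (proj₂ (Fr-Lifted lN f)))))
           (eᴱ-other j (unliftᴱ j Γ) x L i≢j) nothing
    at-index .j (yes refl) =
      pw-≡ refl (eᴱ-same j (unliftᴱ j Γ) x L) (re-expanded (Γ x (j ∷ L)) (env-ok D x (j ∷ L)))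
      where re-expanded : ∀ m → DeclOk (j ∷ L) m → PW m (May.map (e j) (May.map strip m))
            re-expanded (just U) (g , dU) = just (⊑-refl (Good-e-strip g dU))
            re-expanded nothing _ = nothing

substEnv : ℕ → Idx → Env → Env → Env
substEnv x L Δ Γ = remove x L Δ ⊓ᴱ Γ

Substitutable : Env → Tm → Ty → Set
Substitutable Δ P V =
  ∀ {x L U Γ N} → Δ x L ≡ just U → Γ ⊢ N ∶ U → d N ≡ L → 𝓜 N → EJ Δ Γ →
  𝓜 (substVar x L N P) → substEnv x L Δ Γ ⊢ substVar x L N P ∶ V

substEnv-undeclared : ∀ {x L Δ Γ N U y K} → Γ ⊢ N ∶ U → y ∉ names N →
  Δ y K ≡ nothing → substEnv x L Δ Γ y K ≡ nothing
substEnv-undeclared {x} {L} {Δ} {Γ} {y = y} {K} DN yN Δy =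
  trans (⊓ᴱ-≡ (remove x L Δ) Γ y K)
        (cong₂ _⊓ᴹ_ (remove-nothing x L Δ Δy) (¬Fr⇒undeclared DN (λ f → yN (Fr→names f))))

substEnv-,, : ∀ {x L Δ Γ y L′ U′} → ¬ y ≡ x → (∀ K → Γ y K ≡ nothing) →
  ∀ z K → (substEnv x L Δ Γ ,, (y , L′) ↦ U′) z K ≡ substEnv x L (Δ ,, (y , L′) ↦ U′) Γ z K
substEnv-,, {x} {L} {Δ} {Γ} {y} {L′} {U′} y≢x Γy z K with key-case z K y L′
... | inj₁ (refl , refl , _) = begin
  (substEnv x L Δ Γ ,, (y , L′) ↦ U′) y L′       ≡⟨ ,,-here (substEnv x L Δ Γ) y L′ U′ ⟩
  just U′ ⊓ᴹ nothing                               ≡⟨ cong₂ _⊓ᴹ_ declared (sym (Γy L′)) ⟩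
  remove x L (Δ ,, (y , L′) ↦ U′) y L′ ⊓ᴹ Γ y L′   ≡⟨ sym (⊓ᴱ-≡ (remove x L (Δ ,, (y , L′) ↦ U′)) Γ y L′) ⟩
  substEnv x L (Δ ,, (y , L′) ↦ U′) Γ y L′         ∎
  where
    open ≡-Reasoning
    declared : just U′ ≡ remove x L (Δ ,, (y , L′) ↦ U′) y L′
    declared = sym (trans (remove-there (Δ ,, (y , L′) ↦ U′) (ne-fst y≢x)) (,,-here Δ y L′ U′))
... | inj₂ (ne , _) = begin
  (substEnv x L Δ Γ ,, (y , L′) ↦ U′) z K       ≡⟨ ,,-there (substEnv x L Δ Γ) ne ⟩
  substEnv x L Δ Γ z K                           ≡⟨ ⊓ᴱ-≡ (remove x L Δ) Γ z K ⟩
  remove x L Δ z K ⊓ᴹ Γ z K                      ≡⟨ cong (_⊓ᴹ Γ z K) unaffected ⟩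
  remove x L (Δ ,, (y , L′) ↦ U′) z K ⊓ᴹ Γ z K   ≡⟨ sym (⊓ᴱ-≡ (remove x L (Δ ,, (y , L′) ↦ U′)) Γ z K) ⟩
  substEnv x L (Δ ,, (y , L′) ↦ U′) Γ z K        ∎
  where
    open ≡-Reasoning
    unaffected : remove x L Δ z K ≡ remove x L (Δ ,, (y , L′) ↦ U′) z K
    unaffected = remove-cong x L {Δ} {Δ ,, (y , L′) ↦ U′} (sym (,,-there Δ ne))

-- axiom: P is the variable itself, so the result is N's own derivation
subst-ax : ∀ {z T} → Substitutable [ (z , []) ↦ T ] (fv z []) T
subst-ax {z} {T} {x} {L} {U} {Γ} {N} q DN dN mN ej mS with single-case z [] T x L
... | inj₂ (_ , r) = ⊥-elim (nothing≢just (trans (sym r) q))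
... | inj₁ (refl , refl , r) with trans (sym r) q
... | refl rewrite substVar-same x [] N = sub-≅ env-eq DN
  where
    env-eq : ∀ y K → substEnv x [] [ (x , []) ↦ T ] Γ y K ≡ Γ y K
    env-eq y K = trans (⊓ᴱ-≡ (remove x [] [ (x , []) ↦ T ]) Γ y K) (cong (_⊓ᴹ Γ y K) (remove-single x [] T y K))

-- every free variable of P[x^L:=N] is declared, with an ω-dominated type, in
-- the combined environment; the others are undeclared
subst-omega : ∀ {P} → 𝓜 P → Substitutable (envω P) P (ω (d P))
subst-omega {P} m {x} {L} {U} {Γ} {N} q DN dN mN ej mS =
  subᴱ pw (subst (λ D → envω (substVar x L N P) ⊢ substVar x L N P ∶ ω D)
                 (deg-substVar N (𝓜-cl mN) dN [] P) (omega mS))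
  where
    fP : Fr x L P
    fP = declared⇒Fr (omega m) q
    Δ′ : Env
    Δ′ = remove x L (envω P)
    pw : ∀ y K → PW (substEnv x L (envω P) Γ y K) (envω (substVar x L N P) y K)
    pw y K with Fr? y K (substVar x L N P)
    ... | yes f = pw-≡ (⊓ᴱ-≡ Δ′ Γ y K) (envω-yes f)
          (⊑ω-decl (Δ′ y K ⊓ᴹ Γ y K)
                   (DeclOk-⊓ᴹ (Δ′ y K) (Γ y K) (DeclOk-remove x L (envω P) y K (env-ok (omega m) y K)) (env-ok DN y K))
                   declared)
      where declared : ¬ ((Δ′ y K ⊓ᴹ Γ y K) ≡ nothing)
            declared with Fr-substVar⁻ N P f
            ... | inj₁ (fP′ , ne) = ⊓ᴹ-declaredˡ (Δ′ y K) (Γ y K) (trans (remove-there (envω P) ne) (envω-yes fP′))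
            ... | inj₂ fN = ⊓ᴹ-declaredʳ (Δ′ y K) (Γ y K) (proj₂ (Fr⇒declared DN fN))
    ... | no nf =
      pw-≡ (trans (⊓ᴱ-≡ Δ′ Γ y K) (cong₂ _⊓ᴹ_ removed (¬Fr⇒undeclared DN (λ fN → nf (Fr-substVar⁺ʳ N P fP fN)))))
                       (envω-no nf) nothing
      where removed : Δ′ y K ≡ nothing
            removed with remove-case x L (envω P) y K
            ... | inj₁ (_ , _ , r) = r
            ... | inj₂ (ne , r) = trans r (envω-no (λ fP′ → nf (Fr-substVar⁺ˡ N P fP′ ne)))

-- In the abstraction cases the opened name y avoids x and the names of N, so
-- substitution commutes with opening at y.
avoids : ∀ {y x : ℕ} S S₀ R → y ∉ S ++ S₀ ++ x ∷ R → y ∉ S × y ∉ S₀ × ¬ y ≡ x × y ∉ R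
avoids S S₀ R yn =
  let yS , yn′ = ∉-++⁻ S yn
      yS₀ , yxN = ∉-++⁻ S₀ yn′
  in yS , yS₀ , (λ p → yxN (here p)) , (λ p → yxN (there p))

subst-→I : ∀ {Δ L′ B U′ T} (S : List ℕ) → 𝕋 T →
  (∀ y → y ∉ S → Δ y L′ ≡ nothing) →
  (∀ y → y ∉ S → Substitutable (Δ ,, (y , L′) ↦ U′) (B ^ fv y L′) T) →
  Substitutable Δ (lam L′ B) (U′ ⇒ T)
subst-→I {Δ} {L′} {B} {U′} {T} S t fresh-decl IH {x} {L} {U} {Γ} {N} q DN dN mN ej (lam S₀ fm) =
  →I (S ++ S₀ ++ x ∷ names N) t body
  where
    body : ∀ y → y ∉ S ++ S₀ ++ x ∷ names N →
           (substEnv x L Δ Γ y L′ ≡ nothing) ×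
           ((substEnv x L Δ Γ ,, (y , L′) ↦ U′) ⊢ (substVar x L N B ^ fv y L′) ∶ T)
    body y yn with avoids S S₀ (names N) yn
    ... | yS , yS₀ , y≢x , yN =
      substEnv-undeclared {Δ = Δ} DN yN (fresh-decl y yS) , sub-≅ (substEnv-,, y≢x Γy) typed
      where
        Γy : ∀ K → Γ y K ≡ nothing
        Γy K = ¬Fr⇒undeclared DN (λ f → yN (Fr→names f))
        commute : substVar x L N (B ^ fv y L′) ≡ substVar x L N B ^ fv y L′
        commute = substVar-open-comm 0 N B y≢x (𝓜-cl mN)
        typed : substEnv x L (Δ ,, (y , L′) ↦ U′) Γ ⊢ (substVar x L N B ^ fv y L′) ∶ T
        typed = subst (λ Q → _ ⊢ Q ∶ T) commute
                  (IH y yS (trans (,,-there Δ (ne-fst (λ p → y≢x (sym p)))) q) DN dN mN (EJ-,, ej Γy)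
                      (subst 𝓜 (sym commute) (proj₁ (fm y yS₀))))

subst-→I′ : ∀ {Δ L′ B T} (S : List ℕ) → 𝕋 T →
  (∀ y → y ∉ S → Δ y L′ ≡ nothing) →
  (∀ y → y ∉ S → Substitutable Δ (B ^ fv y L′) T) →
  Substitutable Δ (lam L′ B) (ω L′ ⇒ T)
subst-→I′ {Δ} {L′} {B} {T} S t fresh-decl IH {x} {L} {U} {Γ} {N} q DN dN mN ej (lam S₀ fm) =
  →I′ (S ++ S₀ ++ x ∷ names N) t body
  where
    body : ∀ y → y ∉ S ++ S₀ ++ x ∷ names N →
           (substEnv x L Δ Γ y L′ ≡ nothing) × (substEnv x L Δ Γ ⊢ (substVar x L N B ^ fv y L′) ∶ T)
    body y yn with avoids S S₀ (names N) yn
    ... | yS , yS₀ , y≢x , yN =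
      substEnv-undeclared {Δ = Δ} DN yN (fresh-decl y yS) ,
      subst (λ Q → _ ⊢ Q ∶ T) commute (IH y yS q DN dN mN ej (subst 𝓜 (sym commute) (proj₁ (fm y yS₀))))
      where
        commute : substVar x L N (B ^ fv y L′) ≡ substVar x L N B ^ fv y L′
        commute = substVar-open-comm 0 N B y≢x (𝓜-cl mN)

-- Application, x declared on both sides: N's type U₁ ⊓ U₂ is weakened to each
-- side, and the environments recombine because ⊓ distributes over itself.
subst-→E-both : ∀ {Δ₁ Δ₂ P₁ P₂ U′ T x L U₁ U₂ Γ N} → 𝕋 T →
  Δ₁ ⊢ P₁ ∶ (U′ ⇒ T) → Δ₂ ⊢ P₂ ∶ U′ → Δ₁ ◇ᴱ Δ₂ →
  Substitutable Δ₁ P₁ (U′ ⇒ T) → Substitutable Δ₂ P₂ U′ →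
  Δ₁ x L ≡ just U₁ → Δ₂ x L ≡ just U₂ →
  Γ ⊢ N ∶ (U₁ ⊓ U₂) → d N ≡ L → 𝓜 N → EJ (Δ₁ ⊓ᴱ Δ₂) Γ →
  𝓜 (substVar x L N P₁) → 𝓜 (substVar x L N P₂) →
  substEnv x L (Δ₁ ⊓ᴱ Δ₂) Γ ⊢ app (substVar x L N P₁) (substVar x L N P₂) ∶ T
subst-→E-both {Δ₁} {Δ₂} {x = x} {L} {U₁} {U₂} {Γ} t D₁ D₂ jn IH₁ IH₂ q₁ q₂ DN dN mN ej m₁ m₂ =
  subᴱ env-pw (→E t (IH₁ q₁ (subᵀ DN (⊓-lowerˡ ok₁ ok₂)) dN mN (EJ-⊓ˡ ej) m₁)
                     (IH₂ q₂ (subᵀ DN (⊓-lowerʳ ok₁ ok₂)) dN mN (EJ-⊓ʳ ej) m₂)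
                     joinable)
  where
    ok₁ : OfDeg L U₁
    ok₁ = decl-ok D₁ q₁
    ok₂ : OfDeg L U₂
    ok₂ = decl-ok D₂ q₂
    joinable : substEnv x L Δ₁ Γ ◇ᴱ substEnv x L Δ₂ Γ
    joinable = EJ→◇ᴱ (EJ-⊓ (EJ-⊓′ (EJ-remove (EJ-remove′ (◇ᴱ→EJ jn))) (EJ-remove (EJ-⊓ˡ ej)))
                           (EJ-⊓′ (EJ-remove′ (EJ-sym (EJ-⊓ʳ ej))) (EJ-self DN mN)))
    env-pw : ∀ y K → PW (substEnv x L (Δ₁ ⊓ᴱ Δ₂) Γ y K) ((substEnv x L Δ₁ Γ ⊓ᴱ substEnv x L Δ₂ Γ) y K)
    env-pw y K =
      pw-≡ (trans (⊓ᴱ-≡ (remove x L (Δ₁ ⊓ᴱ Δ₂)) Γ y K) (cong (_⊓ᴹ Γ y K) (remove-⊓ x L Δ₁ Δ₂ y K)))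
           (trans (⊓ᴱ-≡ (substEnv x L Δ₁ Γ) (substEnv x L Δ₂ Γ) y K)
                  (cong₂ _⊓ᴹ_ (⊓ᴱ-≡ (remove x L Δ₁) Γ y K) (⊓ᴱ-≡ (remove x L Δ₂) Γ y K)))
           (⊓ᴹ-distribʳ (remove x L Δ₁ y K) (remove x L Δ₂ y K) (Γ y K)
              (DeclOk-remove x L Δ₁ y K (env-ok D₁ y K)) (DeclOk-remove x L Δ₂ y K (env-ok D₂ y K)) (env-ok DN y K))

subst-→E-left : ∀ {Δ₁ Δ₂ P₁ P₂ U′ T x L U Γ N} → 𝕋 T →
  Δ₁ ⊢ P₁ ∶ (U′ ⇒ T) → Δ₂ ⊢ P₂ ∶ U′ → Δ₁ ◇ᴱ Δ₂ → Substitutable Δ₁ P₁ (U′ ⇒ T) →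
  Δ₁ x L ≡ just U → Δ₂ x L ≡ nothing →
  Γ ⊢ N ∶ U → d N ≡ L → 𝓜 N → EJ (Δ₁ ⊓ᴱ Δ₂) Γ → 𝓜 (substVar x L N P₁) →
  substEnv x L (Δ₁ ⊓ᴱ Δ₂) Γ ⊢ app (substVar x L N P₁) (substVar x L N P₂) ∶ T
subst-→E-left {Δ₁} {Δ₂} {P₂ = P₂} {T = T} {x} {L} {Γ = Γ} {N} t D₁ D₂ jn IH₁ q₁ q₂ DN dN mN ej m₁ =
  subst (λ Q → _ ⊢ app _ Q ∶ T)
        (sym (substVar-fresh N P₂ (λ f → nothing≢just (trans (sym q₂) (proj₂ (Fr⇒declared D₂ f))))))
        (subᴱ env-pw (→E t (IH₁ q₁ DN dN mN (EJ-⊓ˡ ej) m₁) D₂ joinable))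
  where
    joinable : substEnv x L Δ₁ Γ ◇ᴱ Δ₂
    joinable = EJ→◇ᴱ (EJ-⊓ (EJ-remove (◇ᴱ→EJ jn)) (EJ-sym (EJ-⊓ʳ ej)))
    env-pw : ∀ y K → PW (substEnv x L (Δ₁ ⊓ᴱ Δ₂) Γ y K) ((substEnv x L Δ₁ Γ ⊓ᴱ Δ₂) y K)
    env-pw y K =
      pw-≡ (trans (⊓ᴱ-≡ (remove x L (Δ₁ ⊓ᴱ Δ₂)) Γ y K)
                  (cong (_⊓ᴹ Γ y K) (trans (remove-⊓ x L Δ₁ Δ₂ y K)
                                           (cong (remove x L Δ₁ y K ⊓ᴹ_) (remove-noop x L Δ₂ q₂ y K)))))
           (trans (⊓ᴱ-≡ (substEnv x L Δ₁ Γ) Δ₂ y K) (cong (_⊓ᴹ Δ₂ y K) (⊓ᴱ-≡ (remove x L Δ₁) Γ y K)))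
           (⊓ᴹ-swap (remove x L Δ₁ y K) (Δ₂ y K) (Γ y K)
              (DeclOk-remove x L Δ₁ y K (env-ok D₁ y K)) (env-ok D₂ y K) (env-ok DN y K))

subst-→E-right : ∀ {Δ₁ Δ₂ P₁ P₂ U′ T x L U Γ N} → 𝕋 T →
  Δ₁ ⊢ P₁ ∶ (U′ ⇒ T) → Δ₂ ⊢ P₂ ∶ U′ → Δ₁ ◇ᴱ Δ₂ → Substitutable Δ₂ P₂ U′ →
  Δ₁ x L ≡ nothing → Δ₂ x L ≡ just U →
  Γ ⊢ N ∶ U → d N ≡ L → 𝓜 N → EJ (Δ₁ ⊓ᴱ Δ₂) Γ → 𝓜 (substVar x L N P₂) →
  substEnv x L (Δ₁ ⊓ᴱ Δ₂) Γ ⊢ app (substVar x L N P₁) (substVar x L N P₂) ∶ T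
subst-→E-right {Δ₁} {Δ₂} {P₁} {T = T} {x = x} {L} {Γ = Γ} {N} t D₁ D₂ jn IH₂ q₁ q₂ DN dN mN ej m₂ =
  subst (λ Q → _ ⊢ app Q _ ∶ T)
        (sym (substVar-fresh N P₁ (λ f → nothing≢just (trans (sym q₁) (proj₂ (Fr⇒declared D₁ f))))))
        (subᴱ env-pw (→E t D₁ (IH₂ q₂ DN dN mN (EJ-⊓ʳ ej) m₂) joinable))
  where
    joinable : Δ₁ ◇ᴱ substEnv x L Δ₂ Γ
    joinable = EJ→◇ᴱ (EJ-⊓′ (EJ-remove′ (◇ᴱ→EJ jn)) (EJ-⊓ˡ ej))
    env-pw : ∀ y K → PW (substEnv x L (Δ₁ ⊓ᴱ Δ₂) Γ y K) ((Δ₁ ⊓ᴱ substEnv x L Δ₂ Γ) y K)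
    env-pw y K =
      pw-≡ (trans (⊓ᴱ-≡ (remove x L (Δ₁ ⊓ᴱ Δ₂)) Γ y K)
                  (cong (_⊓ᴹ Γ y K) (trans (remove-⊓ x L Δ₁ Δ₂ y K)
                                           (cong (_⊓ᴹ remove x L Δ₂ y K) (remove-noop x L Δ₁ q₁ y K)))))
           (trans (⊓ᴱ-≡ Δ₁ (substEnv x L Δ₂ Γ) y K) (cong (Δ₁ y K ⊓ᴹ_) (⊓ᴱ-≡ (remove x L Δ₂) Γ y K)))
           (⊓ᴹ-assoc (Δ₁ y K) (remove x L Δ₂ y K) (Γ y K)
              (env-ok D₁ y K) (DeclOk-remove x L Δ₂ y K (env-ok D₂ y K)) (env-ok DN y K))

substEnv-eᴱ : ∀ {Δ P V Γ N W x L′ j} → Δ ⊢ P ∶ V → Γ ⊢ N ∶ W → Lifted j N →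
  substEnv x (j ∷ L′) (eᴱ j Δ) Γ ⊑ᴱ eᴱ j (substEnv x L′ Δ (unliftᴱ j Γ))
substEnv-eᴱ {Δ} {Γ = Γ} {x = x} {L′} {j} D DN lN y [] =
  pw-≡ (trans (⊓ᴱ-≡ (remove x (j ∷ L′) (eᴱ j Δ)) Γ y [])
              (cong₂ _⊓ᴹ_ (remove-nothing x (j ∷ L′) (eᴱ j Δ) {y} {[]} refl)
                          (pw-nothing (env-unlift-⊑ DN lN y []))))
       refl nothing
substEnv-eᴱ {Δ} {Γ = Γ} {x = x} {L′} {j} D DN lN y (i ∷ K) = at-index i (i ≟ j)
  where
  at-index : ∀ i → Dec (i ≡ j) →
             PW (substEnv x (j ∷ L′) (eᴱ j Δ) Γ y (i ∷ K)) (eᴱ j (substEnv x L′ Δ (unliftᴱ j Γ)) y (i ∷ K))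
  at-index .j (yes refl) =
    pw-≡ (trans (⊓ᴱ-≡ (remove x (j ∷ L′) (eᴱ j Δ)) Γ y (j ∷ K))
                (cong (_⊓ᴹ Γ y (j ∷ K)) (remove-eᴱ x L′ j Δ y K)))
         (trans (eᴱ-same j (substEnv x L′ Δ (unliftᴱ j Γ)) y K)
                (cong (May.map (e j)) (⊓ᴱ-≡ (remove x L′ Δ) (unliftᴱ j Γ) y K)))
         (⊓ᴹ-expand (remove x L′ Δ y K) (Γ y (j ∷ K))
                    (DeclOk-remove x L′ Δ y K (env-ok D y K)) (env-ok DN y (j ∷ K)))
  at-index i (no i≢j) =
    pw-≡ (trans (⊓ᴱ-≡ (remove x (j ∷ L′) (eᴱ j Δ)) Γ y (i ∷ K))
                (cong₂ _⊓ᴹ_ (remove-nothing x (j ∷ L′) (eᴱ j Δ) (eᴱ-other j Δ y K i≢j))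
                            (pw-nothing (subst (PW (Γ y (i ∷ K))) (eᴱ-other j (unliftᴱ j Γ) y K i≢j)
                                               (env-unlift-⊑ DN lN y (i ∷ K))))))
         (eᴱ-other j (substEnv x L′ Δ (unliftᴱ j Γ)) y K i≢j) nothing

EJ-unliftᴱ : ∀ {Δ Γ j} → EJ (eᴱ j Δ) Γ → EJ Δ (unliftᴱ j Γ)
EJ-unliftᴱ {Δ} {Γ} {j} ej = mkEJ λ {y} {K} {K′} a b →
  cong tl (runEJ ej (trans (eᴱ-same j Δ y K) (cong (May.map (e j)) a))
                    (proj₁ (proj₂ (map-just (Γ y (j ∷ K′)) b))))

-- Expansion: x^L has L = j ∷ L′ and N is a lifted term, so the substitution
-- is carried out below ē_j with the unlifted N (expansion inversion).
subst-expn : ∀ {Δ P V} j → Δ ⊢ P ∶ V → Substitutable Δ P V →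
  Substitutable (eᴱ j Δ) (lift j P) (e j V)
subst-expn {Δ} {P} {V} j D IH {x} {L} {U} {Γ} {N} q DN dN mN ej mS with eᴱ-cases j Δ x L
... | inj₁ r = ⊥-elim (nothing≢just (trans (sym r) q))
... | inj₂ (L′ , refl , r) with map-just (Δ x L′) (trans (sym r) q)
... | U₀ , r₀ , refl =
  subst (λ Q → _ ⊢ Q ∶ e j V) lift-substituted (subᴱ (substEnv-eᴱ D DN lN) (expn j substituted))
  where
    inverted : Lifted j N × (unliftᴱ j Γ ⊢ unlift N ∶ U₀)
    inverted = expansion-inversion DN {j} {deg U₀} refl
    lN : Lifted j N
    lN = proj₁ inverted
    lift-substituted : lift j (substVar x L′ (unlift N) P) ≡ substVar x (j ∷ L′) N (lift j P)
    lift-substituted = trans (lift-substVar j x L′ (unlift N) P)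
                             (cong (λ Q → substVar x (j ∷ L′) Q (lift j P)) (lift-unlift lN))
    substituted : substEnv x L′ Δ (unliftᴱ j Γ) ⊢ substVar x L′ (unlift N) P ∶ V
    substituted =
      IH r₀ (proj₂ inverted) (trans (d-unlift N) (cong tl dN)) (𝓜-unlift mN lN) (EJ-unliftᴱ ej)
         (subst 𝓜 (unlift-lift j _) (𝓜-unlift (subst 𝓜 (sym lift-substituted) mS) (Lifted-lift j _)))

-- Subsumption: x^L's type in the premise is below U, so N keeps a type for it.
subst-sub : ∀ {Δ₀ Δ P V₀ V} → Δ₀ ⊢ P ∶ V₀ → V₀ ⊑ V → Δ ⊑ᴱ Δ₀ → Substitutable Δ₀ P V₀ →
  Substitutable Δ P V
subst-sub {Δ₀} {Δ} D₀ p pw IH {x} {L} {U} {Γ} {N} q DN dN mN ej mS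
  with pw-just′ (subst (λ m → PW m (Δ₀ x L)) q (pw x L))
... | U₀ , r₀ , U⊑U₀ = sub (IH r₀ (subᵀ DN U⊑U₀) dN mN ej₀ mS) p env-pw
  where
    ej₀ : EJ Δ₀ Γ
    ej₀ = mkEJ λ {y} {K} a b → runEJ ej (proj₁ (proj₂ (pw-just (subst (PW (Δ y K)) a (pw y K))))) b
    env-pw : ∀ y K → PW (substEnv x L Δ Γ y K) (substEnv x L Δ₀ Γ y K)
    env-pw y K with remove-case x L Δ y K | remove-case x L Δ₀ y K
    ... | inj₁ (_ , _ , r) | inj₁ (_ , _ , r′) =
      pw-≡ (trans (⊓ᴱ-≡ (remove x L Δ) Γ y K) (cong (_⊓ᴹ Γ y K) r))
           (trans (⊓ᴱ-≡ (remove x L Δ₀) Γ y K) (cong (_⊓ᴹ Γ y K) r′)) (pw-refl (Γ y K))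
    ... | inj₂ (_ , r) | inj₂ (_ , r′) =
      pw-≡ (trans (⊓ᴱ-≡ (remove x L Δ) Γ y K) (cong (_⊓ᴹ Γ y K) r))
           (trans (⊓ᴱ-≡ (remove x L Δ₀) Γ y K) (cong (_⊓ᴹ Γ y K) r′))
           (⊓ᴹ-monoˡ (Δ y K) (Δ₀ y K) (Γ y K) (pw y K) (env-ok (sub D₀ p pw) y K) (env-ok D₀ y K) (env-ok DN y K))
    ... | inj₁ (a , b , _) | inj₂ (ne , _) = ⊥-elim (ne (a , b))
    ... | inj₂ (ne , _) | inj₁ (a , b , _) = ⊥-elim (ne (a , b))

subst-lemma : ∀ {Δ P V} → Δ ⊢ P ∶ V → Substitutable Δ P V
subst-lemma (ax t) = subst-ax
subst-lemma (omega m) = subst-omega m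
subst-lemma (→I {M = B} S t prem) =
  subst-→I {B = B} S t (λ y yS → proj₁ (prem y yS)) (λ y yS → subst-lemma (proj₂ (prem y yS)))
subst-lemma (→I′ {M = B} S t prem) =
  subst-→I′ {B = B} S t (λ y yS → proj₁ (prem y yS)) (λ y yS → subst-lemma (proj₂ (prem y yS)))
subst-lemma (→E {Δ₁} {Δ₂} t D₁ D₂ jn) {x} {L} q DN dN mN ej (app m₁ m₂ _ _)
  with Δ₁ x L in q₁ | Δ₂ x L in q₂ | trans (sym (⊓ᴱ-≡ Δ₁ Δ₂ x L)) q
... | just _  | just _  | refl = subst-→E-both t D₁ D₂ jn (subst-lemma D₁) (subst-lemma D₂) q₁ q₂ DN dN mN ej m₁ m₂
... | just _  | nothing | refl = subst-→E-left t D₁ D₂ jn (subst-lemma D₁) q₁ q₂ DN dN mN ej m₁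
... | nothing | just _  | refl = subst-→E-right t D₁ D₂ jn (subst-lemma D₂) q₁ q₂ DN dN mN ej m₂
... | nothing | nothing | ()
subst-lemma (⊓I p D₁ D₂) q DN dN mN ej mS = ⊓I p (subst-lemma D₁ q DN dN mN ej mS) (subst-lemma D₂ q DN dN mN ej mS)
subst-lemma (expn j D) = subst-expn j D (subst-lemma D)
subst-lemma (sub D p pw) = subst-sub D p pw (subst-lemma D)

SubjectReduces : Env → Tm → Ty → Set
SubjectReduces Γ M V = ∀ {M′} → 𝓜 M → 𝓜 M′ → M ▷β M′ → (Γ ↾ M′) ⊢ M′ ∶ V

-- reduction keeps the degree, and the free variables of the reduct are free in M
sr-omega : ∀ {M} → 𝓜 M → SubjectReduces (envω M) M (ω (d M))
sr-omega {M} mM {M′} _ m′ r =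
  sub-≅ env-eq (subst (λ D → envω M′ ⊢ M′ ∶ ω D) (deg-▷β (𝓜-cl mM) r) (omega m′))
  where
    env-eq : ∀ y K → (envω M ↾ M′) y K ≡ envω M′ y K
    env-eq y K with Fr? y K M′
    ... | yes f = trans (↾-yes (envω M) f) (trans (envω-yes (Fr-▷β r f)) (sym (envω-yes f)))
    ... | no nf = trans (↾-no (envω M) nf) (sym (envω-no nf))

reduce-body : ∀ {Δ : ℕ → Env} {L B B′ T} (S : List ℕ) →
  (∀ y → y ∉ S → SubjectReduces (Δ y) (B ^ fv y L) T) →
  𝓜 (lam L B) → 𝓜 (lam L B′) → lam L B ▷β lam L B′ →
  Σ (List ℕ) λ S* → ∀ y → y ∉ S* → y ∉ S × ((Δ y ↾ (B′ ^ fv y L)) ⊢ (B′ ^ fv y L) ∶ T)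
reduce-body S IH (lam S₁ m) (lam S₂ m′) (lam S₃ r) =
  S ++ S₁ ++ S₂ ++ S₃ , λ y yn →
    let yS , yn₁ = ∉-++⁻ S yn
        yS₁ , yn₂ = ∉-++⁻ S₁ yn₁
        yS₂ , yS₃ = ∉-++⁻ S₂ yn₂
    in yS , IH y yS (proj₁ (m y yS₁)) (proj₁ (m′ y yS₂)) (r y yS₃)

-- Abstraction whose bound variable survives in the reduct: rule →I again.
sr-→I-occurs : ∀ {Γ L B′ U T} (S : List ℕ) → 𝕋 T → Occ 0 B′ →
  (∀ y → y ∉ S → (Γ y L ≡ nothing) × (((Γ ,, (y , L) ↦ U) ↾ (B′ ^ fv y L)) ⊢ (B′ ^ fv y L) ∶ T)) →
  (Γ ↾ lam L B′) ⊢ lam L B′ ∶ (U ⇒ T)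
sr-→I-occurs {Γ} {L} {B′} {U} {T} S t o body = →I S t λ y yS →
  ↾-nothing Γ (lam L B′) (proj₁ (body y yS)) , sub-≅ (env-eq y) (proj₂ (body y yS))
  where
    env-eq : ∀ y z K → ((Γ ↾ lam L B′) ,, (y , L) ↦ U) z K ≡ ((Γ ,, (y , L) ↦ U) ↾ (B′ ^ fv y L)) z K
    env-eq y z K with key-case z K y L
    ... | inj₁ (refl , refl , _) =
      trans (,,-here (Γ ↾ lam L B′) y L U)
            (sym (trans (↾-yes (Γ ,, (y , L) ↦ U) (Fr-open-occ 0 (fv y L) B′ o fr-v)) (,,-here Γ y L U)))
    ... | inj₂ (ne , _) =
      trans (,,-there (Γ ↾ lam L B′) ne)
            (trans (↾-lam-open Γ {y} {L} {B′} ne) (↾-cong {Γ} {Γ ,, (y , L) ↦ U} (B′ ^ fv y L) (sym (,,-there Γ ne))))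

-- Abstraction whose bound variable was erased by the reduction: the reduct
-- gets ω^L ⇒ T by rule →I′, and U ⇒ T by subsumption since U ⊑ ω^L.
sr-→I-vacuous : ∀ {Γ L B′ U T} (S : List ℕ) → 𝕋 T → ¬ Occ 0 B′ → OfDeg L U →
  (∀ y → y ∉ S → (Γ y L ≡ nothing) × (((Γ ,, (y , L) ↦ U) ↾ (B′ ^ fv y L)) ⊢ (B′ ^ fv y L) ∶ T)) →
  (Γ ↾ lam L B′) ⊢ lam L B′ ∶ (U ⇒ T)
sr-→I-vacuous {Γ} {L} {B′} {U} {T} S t no-occ ((U° , u , U≈U°) , dU) body =
  subᵀ (→I′ (S ++ names B′) t λ y yn →
          let yS , yB = ∉-++⁻ S yn in
          ↾-nothing Γ (lam L B′) (proj₁ (body y yS)) , sub-≅ (env-eq y yB (proj₁ (body y yS))) (proj₂ (body y yS)))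
       ω⇒T⊑U⇒T
  where
    ω⇒T⊑U⇒T : (ω L ⇒ T) ⊑ (U ⇒ T)
    ω⇒T⊑U⇒T =
      ⇒-mono (arr (omega L) t) (arr u t)
             (subst (λ Z → U° ⊑ ω Z) (trans (sym (deg-≈ U≈U°)) dU) (ω-top (Good-𝕌 u))) ⊑-id
      ⊑∘ ⊑-refl (⇒-cong (≈-sym U≈U°) ≈-refl)
    env-eq : ∀ y → y ∉ names B′ → Γ y L ≡ nothing →
             ∀ z K → (Γ ↾ lam L B′) z K ≡ ((Γ ,, (y , L) ↦ U) ↾ (B′ ^ fv y L)) z K
    env-eq y yB Γy z K with key-case z K y L
    ... | inj₁ (refl , refl , _) = trans (↾-nothing Γ (lam L B′) Γy) (sym (↾-no (Γ ,, (y , L) ↦ U) not-free))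
      where not-free : ¬ Fr y L (B′ ^ fv y L)
            not-free g with Fr-open⁻occ 0 (fv y L) B′ g
            ... | inj₁ h = yB (Fr→names h)
            ... | inj₂ o = no-occ o
    ... | inj₂ (ne , _) =
      trans (↾-lam-open Γ {y} {L} {B′} ne) (↾-cong {Γ} {Γ ,, (y , L) ↦ U} (B′ ^ fv y L) (sym (,,-there Γ ne)))

sr-→I : ∀ {Γ L B U T} (S : List ℕ) → 𝕋 T →
  (prem : ∀ y → y ∉ S → (Γ y L ≡ nothing) × ((Γ ,, (y , L) ↦ U) ⊢ (B ^ fv y L) ∶ T)) →
  (∀ y → y ∉ S → SubjectReduces (Γ ,, (y , L) ↦ U) (B ^ fv y L) T) →
  SubjectReduces Γ (lam L B) (U ⇒ T)
sr-→I {Γ} {L} {B} {U} {T} S t prem IH m m′ r@(lam {M′ = B′} _ _) with reduce-body S IH m m′ r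
... | S* , reduced = by-occurrence (occ? 0 B′)
  where
    body : ∀ y → y ∉ S* → (Γ y L ≡ nothing) × (((Γ ,, (y , L) ↦ U) ↾ (B′ ^ fv y L)) ⊢ (B′ ^ fv y L) ∶ T)
    body y yS* = proj₁ (prem y (proj₁ (reduced y yS*))) , proj₂ (reduced y yS*)
    U-ok : OfDeg L U
    U-ok = decl-ok (proj₂ (prem (fresh S) (fresh-∉ S))) (,,-here Γ (fresh S) L U)
    by-occurrence : Dec (Occ 0 B′) → (Γ ↾ lam L B′) ⊢ lam L B′ ∶ (U ⇒ T)
    by-occurrence (yes o) = sr-→I-occurs S* t o body
    by-occurrence (no no-occ) = sr-→I-vacuous S* t no-occ U-ok body

sr-→I′ : ∀ {Γ L B T} (S : List ℕ) → 𝕋 T →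
  (prem : ∀ y → y ∉ S → (Γ y L ≡ nothing) × (Γ ⊢ (B ^ fv y L) ∶ T)) →
  (∀ y → y ∉ S → SubjectReduces Γ (B ^ fv y L) T) →
  SubjectReduces Γ (lam L B) (ω L ⇒ T)
sr-→I′ {Γ} {L} S t prem IH m m′ r@(lam {M′ = B′} _ _) with reduce-body {λ _ → Γ} S IH m m′ r
... | S* , body = →I′ S* t λ y yS* →
  let yS , typed = body y yS* in
  ↾-nothing Γ (lam L B′) (proj₁ (prem y yS)) , sub-≅ (env-eq y (proj₁ (prem y yS))) typed
  where
    env-eq : ∀ y → Γ y L ≡ nothing → ∀ z K → (Γ ↾ lam L B′) z K ≡ (Γ ↾ (B′ ^ fv y L)) z K
    env-eq y Γy z K with key-case z K y L
    ... | inj₁ (refl , refl , _) = trans (↾-nothing Γ (lam L B′) Γy) (sym (↾-nothing Γ (B′ ^ fv y L) Γy))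
    ... | inj₂ (ne , _) = ↾-lam-open Γ {y} {L} {B′} ne

sr-appˡ : ∀ {Γ₁ Γ₂ M₁ M₁′ M₂ U T} → 𝕋 T → Γ₁ ⊢ M₁ ∶ (U ⇒ T) → Γ₂ ⊢ M₂ ∶ U → Γ₁ ◇ᴱ Γ₂ →
  (Γ₁ ↾ M₁′) ⊢ M₁′ ∶ (U ⇒ T) → ((Γ₁ ⊓ᴱ Γ₂) ↾ app M₁′ M₂) ⊢ app M₁′ M₂ ∶ T
sr-appˡ {Γ₁} {Γ₂} {M₁′ = M₁′} {M₂} t D₁ D₂ jn D₁′ =
  subᴱ env-pw (→E t D₁′ D₂ (EJ→◇ᴱ (EJ-↾ {N = M₁′} (◇ᴱ→EJ jn))))
  where
    env-pw : ∀ y K → PW (((Γ₁ ⊓ᴱ Γ₂) ↾ app M₁′ M₂) y K) (((Γ₁ ↾ M₁′) ⊓ᴱ Γ₂) y K)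
    env-pw y K with Fr? y K M₁′
    ... | yes f = pw-≡ (↾-yes {N = app M₁′ M₂} (Γ₁ ⊓ᴱ Γ₂) (fr-l f))
                       (trans (⊓ᴱ-≡ (Γ₁ ↾ M₁′) Γ₂ y K) (trans (cong (_⊓ᴹ Γ₂ y K) (↾-yes Γ₁ f)) (sym (⊓ᴱ-≡ Γ₁ Γ₂ y K))))
                       (pw-refl _)
    ... | no nf with Fr? y K M₂
    ... | yes g = pw-≡ (trans (↾-yes {N = app M₁′ M₂} (Γ₁ ⊓ᴱ Γ₂) (fr-r g))
                              (trans (⊓ᴱ-≡ Γ₁ Γ₂ y K) (cong (Γ₁ y K ⊓ᴹ_) q)))
                       (trans (⊓ᴱ-≡ (Γ₁ ↾ M₁′) Γ₂ y K) (trans (cong (_⊓ᴹ Γ₂ y K) (↾-no Γ₁ nf)) q))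
                       (⊓ᴹ-lowerʳ (Γ₁ y K) (env-ok D₁ y K) (DeclOk-≡ (sym q) (env-ok D₂ y K)))
      where q : Γ₂ y K ≡ just (proj₁ (Fr⇒declared D₂ g))
            q = proj₂ (Fr⇒declared D₂ g)
    ... | no ng = pw-≡ (↾-no (Γ₁ ⊓ᴱ Γ₂) (not-app nf ng))
                       (trans (⊓ᴱ-≡ (Γ₁ ↾ M₁′) Γ₂ y K) (cong₂ _⊓ᴹ_ (↾-no Γ₁ nf) (¬Fr⇒undeclared D₂ ng)))
                       nothing

sr-appʳ : ∀ {Γ₁ Γ₂ M₁ M₂ M₂′ U T} → 𝕋 T → Γ₁ ⊢ M₁ ∶ (U ⇒ T) → Γ₂ ⊢ M₂ ∶ U → Γ₁ ◇ᴱ Γ₂ →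
  (Γ₂ ↾ M₂′) ⊢ M₂′ ∶ U → ((Γ₁ ⊓ᴱ Γ₂) ↾ app M₁ M₂′) ⊢ app M₁ M₂′ ∶ T
sr-appʳ {Γ₁} {Γ₂} {M₁} {M₂′ = M₂′} t D₁ D₂ jn D₂′ =
  subᴱ env-pw (→E t D₁ D₂′ (EJ→◇ᴱ (EJ-↾′ {N = M₂′} (◇ᴱ→EJ jn))))
  where
    env-pw : ∀ y K → PW (((Γ₁ ⊓ᴱ Γ₂) ↾ app M₁ M₂′) y K) ((Γ₁ ⊓ᴱ (Γ₂ ↾ M₂′)) y K)
    env-pw y K with Fr? y K M₂′
    ... | yes f = pw-≡ (↾-yes {N = app M₁ M₂′} (Γ₁ ⊓ᴱ Γ₂) (fr-r f))
                       (trans (⊓ᴱ-≡ Γ₁ (Γ₂ ↾ M₂′) y K) (trans (cong (Γ₁ y K ⊓ᴹ_) (↾-yes Γ₂ f)) (sym (⊓ᴱ-≡ Γ₁ Γ₂ y K))))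
                       (pw-refl _)
    ... | no nf with Fr? y K M₁
    ... | yes g = pw-≡ (trans (↾-yes {N = app M₁ M₂′} (Γ₁ ⊓ᴱ Γ₂) (fr-l g))
                              (trans (⊓ᴱ-≡ Γ₁ Γ₂ y K) (cong (_⊓ᴹ Γ₂ y K) q)))
                       (trans (⊓ᴱ-≡ Γ₁ (Γ₂ ↾ M₂′) y K) (trans (cong (Γ₁ y K ⊓ᴹ_) (↾-no Γ₂ nf)) (cong (_⊓ᴹ nothing) q)))
                       (⊓ᴹ-lowerˡ (Γ₂ y K) (DeclOk-≡ (sym q) (env-ok D₁ y K)) (env-ok D₂ y K))
      where q : Γ₁ y K ≡ just (proj₁ (Fr⇒declared D₁ g))
            q = proj₂ (Fr⇒declared D₁ g)
    ... | no ng = pw-≡ (↾-no (Γ₁ ⊓ᴱ Γ₂) (not-app ng nf))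
                       (trans (⊓ᴱ-≡ Γ₁ (Γ₂ ↾ M₂′) y K) (cong₂ _⊓ᴹ_ (¬Fr⇒undeclared D₁ ng) (↾-no Γ₂ nf)))
                       nothing

-- β-redex whose abstraction was typed by →I: the substitution lemma applied
-- to the body opened at a fresh name x, which must occur in the body.
sr-beta-→I : ∀ {Γ₁ Γ₂ L B N U T} (S : List ℕ) → d N ≡ L → 𝓜 N → 𝓜 (B ^ N) →
  Γ₁ ⊢ lam L B ∶ (U ⇒ T) → Γ₂ ⊢ N ∶ U → Γ₁ ◇ᴱ Γ₂ →
  (∀ x → x ∉ S → (Γ₁ x L ≡ nothing) × ((Γ₁ ,, (x , L) ↦ U) ⊢ (B ^ fv x L) ∶ T)) →
  ((Γ₁ ⊓ᴱ Γ₂) ↾ (B ^ N)) ⊢ (B ^ N) ∶ T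
sr-beta-→I {Γ₁} {Γ₂} {L} {B} {N} {U} {T} S dN mN m′ D₁ D₂ jn body =
  sub-≅ env-eq (subst (λ Q → substEnv x L (Γ₁ ,, (x , L) ↦ U) Γ₂ ⊢ Q ∶ T) (substVar-open-var 0 N B xB) substituted)
  where
    x : ℕ
    x = fresh (S ++ names B ++ names N)
    xS : x ∉ S
    xS = proj₁ (∉-++⁻ S (fresh-∉ (S ++ names B ++ names N)))
    xB : x ∉ names B
    xB = proj₁ (∉-++⁻ (names B) (proj₂ (∉-++⁻ S (fresh-∉ (S ++ names B ++ names N)))))
    xN : x ∉ names N
    xN = proj₂ (∉-++⁻ (names B) (proj₂ (∉-++⁻ S (fresh-∉ (S ++ names B ++ names N)))))
    Γx : Γ₁ x L ≡ nothing
    Γx = proj₁ (body x xS)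
    Dx : (Γ₁ ,, (x , L) ↦ U) ⊢ (B ^ fv x L) ∶ T
    Dx = proj₂ (body x xS)
    substituted : substEnv x L (Γ₁ ,, (x , L) ↦ U) Γ₂ ⊢ substVar x L N (B ^ fv x L) ∶ T
    substituted = subst-lemma Dx (,,-here Γ₁ x L U) D₂ dN mN
                    (EJ-,, (◇ᴱ→EJ jn) (λ K → ¬Fr⇒undeclared D₂ (λ f → xN (Fr→names f))))
                    (subst 𝓜 (sym (substVar-open-var 0 N B xB)) m′)
    occurs : Occ 0 B
    occurs = Occ-openv 0 B xB (declared⇒Fr Dx (,,-here Γ₁ x L U))
    env-eq : ∀ y K → ((Γ₁ ⊓ᴱ Γ₂) ↾ (B ^ N)) y K ≡ substEnv x L (Γ₁ ,, (x , L) ↦ U) Γ₂ y K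
    env-eq y K with Fr? y K (B ^ N)
    ... | yes g = trans (↾-yes (Γ₁ ⊓ᴱ Γ₂) g)
                    (trans (⊓ᴱ-≡ Γ₁ Γ₂ y K)
                      (trans (cong (_⊓ᴹ Γ₂ y K) (sym (remove-,, x L Γ₁ U Γx y K)))
                             (sym (⊓ᴱ-≡ (remove x L (Γ₁ ,, (x , L) ↦ U)) Γ₂ y K))))
    ... | no ng = trans (↾-no (Γ₁ ⊓ᴱ Γ₂) ng)
                    (sym (trans (⊓ᴱ-≡ (remove x L (Γ₁ ,, (x , L) ↦ U)) Γ₂ y K)
                      (cong₂ _⊓ᴹ_ (trans (remove-,, x L Γ₁ U Γx y K)
                                         (¬Fr⇒undeclared D₁ λ { (fr-λ h) → ng (Fr-open⁺ 0 N B h) }))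
                                  (¬Fr⇒undeclared D₂ (λ h → ng (Fr-open-occ 0 N B occurs h))))))

-- β-redex whose abstraction was typed by →I′: the bound variable does not
-- occur, the contractum is the body itself, typed in Γ₁.
sr-beta-→I′ : ∀ {Γ₁ Γ₂ L B N U T} (S : List ℕ) →
  Γ₁ ⊢ lam L B ∶ (U ⇒ T) → Γ₂ ⊢ N ∶ U →
  (∀ x → x ∉ S → (Γ₁ x L ≡ nothing) × (Γ₁ ⊢ (B ^ fv x L) ∶ T)) →
  ((Γ₁ ⊓ᴱ Γ₂) ↾ (B ^ N)) ⊢ (B ^ N) ∶ T
sr-beta-→I′ {Γ₁} {Γ₂} {L} {B} {N} {T = T} S D₁ D₂ body =
  subst (λ Q → ((Γ₁ ⊓ᴱ Γ₂) ↾ Q) ⊢ Q ∶ T) (sym (open-nocc 0 N B no-occ)) (subᴱ env-pw typed)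
  where
    x : ℕ
    x = fresh (S ++ names B)
    xS : x ∉ S
    xS = proj₁ (∉-++⁻ S (fresh-∉ (S ++ names B)))
    no-occ : ¬ Occ 0 B
    no-occ o = nothing≢just (trans (sym (proj₁ (body x xS)))
                                   (proj₂ (Fr⇒declared (proj₂ (body x xS)) (Fr-open-occ 0 (fv x L) B o fr-v))))
    typed : Γ₁ ⊢ B ∶ T
    typed = subst (λ Q → Γ₁ ⊢ Q ∶ T) (open-nocc 0 (fv x L) B no-occ) (proj₂ (body x xS))
    env-pw : ∀ y K → PW (((Γ₁ ⊓ᴱ Γ₂) ↾ B) y K) (Γ₁ y K)
    env-pw y K with Fr? y K B
    ... | yes g = pw-≡ (trans (↾-yes (Γ₁ ⊓ᴱ Γ₂) g) (trans (⊓ᴱ-≡ Γ₁ Γ₂ y K) (cong (_⊓ᴹ Γ₂ y K) q))) q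
                       (⊓ᴹ-lowerˡ (Γ₂ y K) (DeclOk-≡ (sym q) (env-ok D₁ y K)) (env-ok D₂ y K))
      where q : Γ₁ y K ≡ just (proj₁ (Fr⇒declared D₁ (fr-λ g)))
            q = proj₂ (Fr⇒declared D₁ (fr-λ g))
    ... | no ng = pw-≡ (↾-no (Γ₁ ⊓ᴱ Γ₂) ng) (¬Fr⇒undeclared D₁ λ { (fr-λ h) → ng h }) nothing

-- β-redex: the generation lemma tells which rule typed the abstraction.
sr-beta : ∀ {Γ₁ Γ₂ L B N U T} → d N ≡ L → 𝓜 N → 𝓜 (B ^ N) →
  Γ₁ ⊢ lam L B ∶ (U ⇒ T) → Γ₂ ⊢ N ∶ U → Γ₁ ◇ᴱ Γ₂ →
  ((Γ₁ ⊓ᴱ Γ₂) ↾ (B ^ N)) ⊢ (B ^ N) ∶ T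
sr-beta dN mN m′ D₁ D₂ jn with lam-generation D₁ refl (here refl)
... | inj₁ (S , body) = sr-beta-→I S dN mN m′ D₁ D₂ jn body
... | inj₂ (_ , S , body) = sr-beta-→I′ S D₁ D₂ body

-- Expansion: the reduction of a lifted term is the lifting of a reduction.
sr-expn : ∀ {Γ M U} j → SubjectReduces Γ M U → SubjectReduces (eᴱ j Γ) (lift j M) (e j U)
sr-expn {Γ} {M} {U} j IH {M′} m m′ r =
  subst (λ Q → (eᴱ j Γ ↾ M′) ⊢ Q ∶ e j U) (lift-unlift lM′) (sub-≅ env-eq (expn j reduced))
  where
    unlifted : Lifted j M′ × (unlift (lift j M) ▷β unlift M′)
    unlifted = ▷β-unlift (Lifted-lift j M) r
    lM′ : Lifted j M′
    lM′ = proj₁ unlifted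
    reduced : (Γ ↾ unlift M′) ⊢ unlift M′ ∶ U
    reduced = IH (subst 𝓜 (unlift-lift j M) (𝓜-unlift m (Lifted-lift j M))) (𝓜-unlift m′ lM′)
                 (subst (_▷β unlift M′) (unlift-lift j M) (proj₂ unlifted))
    env-eq : ∀ y K → (eᴱ j Γ ↾ M′) y K ≡ eᴱ j (Γ ↾ unlift M′) y K
    env-eq y [] = ↾-nothing (eᴱ j Γ) M′ refl
    env-eq y (i ∷ K) = at-index i (i ≟ j)
      where
      at-index : ∀ i → Dec (i ≡ j) → (eᴱ j Γ ↾ M′) y (i ∷ K) ≡ eᴱ j (Γ ↾ unlift M′) y (i ∷ K)
      at-index i (no i≢j) =
        trans (↾-nothing (eᴱ j Γ) M′ (eᴱ-other j Γ y K i≢j)) (sym (eᴱ-other j (Γ ↾ unlift M′) y K i≢j))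
      at-index .j (yes refl) with Fr? y K (unlift M′)
      ... | yes g = trans (↾-yes (eᴱ j Γ) (Fr-unlift⁻ lM′ g))
                      (trans (eᴱ-same j Γ y K)
                        (trans (cong (May.map (e j)) (sym (↾-yes Γ g))) (sym (eᴱ-same j (Γ ↾ unlift M′) y K))))
      ... | no ng = trans (↾-no (eᴱ j Γ) (λ g → ng (Fr-unlift⁺ g)))
                      (sym (trans (eᴱ-same j (Γ ↾ unlift M′) y K) (cong (May.map (e j)) (↾-no Γ ng))))

-- Subsumption: restriction is monotone for ⊑ᴱ.
sr-sub : ∀ {Γ₀ Γ M U U′} → U ⊑ U′ → Γ ⊑ᴱ Γ₀ → SubjectReduces Γ₀ M U → SubjectReduces Γ M U′
sr-sub {Γ₀} {Γ} p pw IH {M′} m m′ r = sub (IH m m′ r) p pw′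
  where
    pw′ : ∀ y K → PW ((Γ ↾ M′) y K) ((Γ₀ ↾ M′) y K)
    pw′ y K with Fr? y K M′
    ... | yes f = pw-≡ (↾-yes Γ f) (↾-yes Γ₀ f) (pw y K)
    ... | no nf = pw-≡ (↾-no Γ nf) (↾-no Γ₀ nf) nothing

subject-reduction-step : ∀ {Γ M V} → Γ ⊢ M ∶ V → SubjectReduces Γ M V
subject-reduction-step (ax t) _ _ ()
subject-reduction-step (omega m) = sr-omega m
subject-reduction-step (→I S t prem) =
  sr-→I S t prem (λ y yS → subject-reduction-step (proj₂ (prem y yS)))
subject-reduction-step (→I′ S t prem) =
  sr-→I′ S t prem (λ y yS → subject-reduction-step (proj₂ (prem y yS)))
subject-reduction-step (→E t D₁ D₂ jn) (app m₁ m₂ _ _) m′ (beta dN) = sr-beta dN m₂ m′ D₁ D₂ jn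
subject-reduction-step (→E t D₁ D₂ jn) (app m₁ m₂ _ _) (app m₁′ _ _ _) (appˡ r) =
  sr-appˡ t D₁ D₂ jn (subject-reduction-step D₁ m₁ m₁′ r)
subject-reduction-step (→E t D₁ D₂ jn) (app m₁ m₂ _ _) (app _ m₂′ _ _) (appʳ r) =
  sr-appʳ t D₁ D₂ jn (subject-reduction-step D₂ m₂ m₂′ r)
subject-reduction-step (⊓I p D₁ D₂) m m′ r =
  ⊓I p (subject-reduction-step D₁ m m′ r) (subject-reduction-step D₂ m m′ r)
subject-reduction-step (expn j D) = sr-expn j (subject-reduction-step D)
subject-reduction-step (sub D p pw) = sr-sub p pw (subject-reduction-step D)

restrict-self : ∀ {Γ M U} → Γ ⊢ M ∶ U → (Γ ↾ M) ⊢ M ∶ U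
restrict-self {Γ} {M} D = sub-≅ env-eq D
  where env-eq : ∀ y K → (Γ ↾ M) y K ≡ Γ y K
        env-eq y K with Fr? y K M
        ... | yes f = ↾-yes Γ f
        ... | no nf = trans (↾-no Γ nf) (sym (¬Fr⇒undeclared D nf))

Fr-star : ∀ {M N y K} → M ▷β* N → Fr y K N → Fr y K M
Fr-star ε f = f
Fr-star ((_ , _ , r) ◅ rs) f = Fr-▷β r (Fr-star rs f)

↾-↾ : ∀ Γ {M₁ N} → M₁ ▷β* N → ∀ y K → (Γ ↾ N) y K ≡ ((Γ ↾ M₁) ↾ N) y K
↾-↾ Γ {M₁} {N} rs y K with Fr? y K N
... | yes f = trans (↾-yes Γ f) (sym (trans (↾-yes (Γ ↾ M₁) f) (↾-yes Γ (Fr-star rs f))))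
... | no nf = trans (↾-no Γ nf) (sym (↾-no (Γ ↾ M₁) nf))

subject-reduction : ∀ {Γ M N U} → Γ ⊢ M ∶ U → M ▷β* N → (Γ ↾ N) ⊢ N ∶ U
subject-reduction D ε = restrict-self D
subject-reduction {Γ} D ((m , m₁ , r) ◅ rs) =
  sub-≅ (↾-↾ Γ rs) (subject-reduction (subject-reduction-step D m m₁ r) rs)

▷h*⇒▷β* : ∀ {M N} → M ▷h* N → M ▷β* N
▷h*⇒▷β* ε = ε
▷h*⇒▷β* ((m , m′ , r) ◅ rs) = (m , m′ , ▷h⇒▷β r) ◅ ▷h*⇒▷β* rs

corollary1 :
    (∀ {Γ M N U} → Γ ⊢ M ∶ U → M ▷β* N → (Γ ↾ N) ⊢ N ∶ U) ×
    (∀ {Γ M N U} → Γ ⊢ M ∶ U → M ▷h* N → (Γ ↾ N) ⊢ N ∶ U)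
corollary1 = subject-reduction , λ D rs → subject-reduction D (▷h*⇒▷β* rs)
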